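{- Let $H$ be a non-chorded biconnected graph of order at least four. Then there is a cycle $C=F_0$ in $H$ such that either $C$ is a Hamiltonian cycle of $H$ and $E(H)=E(C)$, or there exist an integer $k\geq 1$ and paths $P_1,\ldots,P_k$ in $H$, each with at least two edges, where $P_i$ has distinct endpoints $a_i\neq b_i$, such that $E(H)$ is the disjoint union of $E(C),E(P_1),\ldots,E(P_k)$, and defining $F_i=P_i\cup F_{i-1}$ for $1\le i\le k$, we have for all $1\leq i\leq k$: $V(P_i)\cap V(F_{i-1})=\{a_i,b_i\}$, $F_i$ is a non-chorded biconnected graph, and $F_k=H$.
   Context: All graphs are finite, simple and undirected. A chord of a cycle $C$ is an edge joining two non-consecutive vertices of $C$; a graph is non-chorded if it contains no cycle having a chord. A biconnected graph is a non-separable graph (connected, with no cut-vertex); any two vertices, and any two edges, of a biconnected graph lie on a common cycle. A Hamiltonian cycle of $H$ is a cycle containing all vertices of $H$. -}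

module Defs where

open import Data.Nat using (ℕ; zero; suc; _≤_; _<_)
open import Data.Fin using (Fin; toℕ)
open import Data.Bool using (Bool; true; false)
open import Data.List using (List; []; _∷_; _++_; length; [_])
open import Data.List.Membership.Propositional using (_∈_)
open import Data.List.Relation.Unary.All using (All)
open import Data.List.Relation.Unary.Linked using (Linked)
open import Data.List.Relation.Unary.Unique.Propositional using (Unique)
open import Data.Product using (Σ; Σ-syntax; ∃; _×_)
open import Data.Sum using (_⊎_)
open import Data.Unit using (⊤)
open import Data.Empty using (⊥)
open import Relation.Binary.PropositionalEquality using (_≡_; _≢_)
open import Relation.Nullary using (¬_)
open import Function.Bundles using (_⇔_)

record Graph (n : ℕ) : Set where
  field
    adj    : Fin n → Fin n → Bool
    sym    : ∀ u v → adj u v ≡ adj v u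
    irrefl : ∀ u → adj u u ≡ false

record SubGraph (n : ℕ) : Set₁ where
  field
    V : Fin n → Set
    E : Fin n → Fin n → Set
open SubGraph public

full : ∀ {n} → Graph n → SubGraph n
full H = record { V = λ _ → ⊤ ; E = λ u v → Graph.adj H u v ≡ true }

_─_ : ∀ {n} → SubGraph n → Fin n → SubGraph n
G ─ x = record { V = λ w → V G w × w ≢ x
               ; E = λ u v → E G u v × u ≢ x × v ≢ x }

last′ : ∀ {n} → Fin n → List (Fin n) → Fin n
last′ x [] = x
last′ _ (y ∷ ys) = last′ y ys

Ends : ∀ {n} → List (Fin n) → Fin n → Fin n → Set
Ends [] a b = ⊥
Ends (x ∷ xs) a b = x ≡ a × last′ x xs ≡ b

IsPath : ∀ {n} → SubGraph n → List (Fin n) → Set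
IsPath G [] = ⊥
IsPath G (x ∷ xs) = Unique (x ∷ xs) × All (V G) (x ∷ xs) × Linked (E G) (x ∷ xs)

IsCycle : ∀ {n} → SubGraph n → List (Fin n) → Set
IsCycle G [] = ⊥
IsCycle G (x ∷ xs) = 3 ≤ length (x ∷ xs) × Unique (x ∷ xs)
                   × All (V G) (x ∷ xs) × Linked (E G) (x ∷ xs ++ [ x ])

PathEdge : ∀ {n} → List (Fin n) → Fin n → Fin n → Set
PathEdge [] u v = ⊥
PathEdge (x ∷ []) u v = ⊥
PathEdge (x ∷ y ∷ xs) u v = ((u ≡ x × v ≡ y) ⊎ (u ≡ y × v ≡ x)) ⊎ PathEdge (y ∷ xs) u v

CycEdge : ∀ {n} → List (Fin n) → Fin n → Fin n → Set
CycEdge [] u v = ⊥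
CycEdge (x ∷ xs) u v = PathEdge (x ∷ xs ++ [ x ]) u v

Connected : ∀ {n} → SubGraph n → Set
Connected G = ∀ u v → V G u → V G v →
  Σ[ ps ∈ List _ ] (IsPath G ps × Ends ps u v)

Biconnected : ∀ {n} → SubGraph n → Set
Biconnected G = Connected G × (∀ x → V G x → Connected (G ─ x))

NonChorded : ∀ {n} → SubGraph n → Set
NonChorded G = ∀ cs → IsCycle G cs → ∀ u v → E G u v → u ∈ cs → v ∈ cs → CycEdge cs u v

-- F i = C ∪ P₁ ∪ … ∪ P_i  (the paths are indexed 0 … k-1 by Fin k, so P j is
-- P_{j+1} of the paper, and F i uses those P j with toℕ j < i).
F : ∀ {n k} → List (Fin n) → (Fin k → List (Fin n)) → ℕ → SubGraph n
F C P i = record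
  { V = λ w → w ∈ C ⊎ Σ[ j ∈ Fin _ ] (toℕ j < i × w ∈ P j)
  ; E = λ u v → CycEdge C u v ⊎ Σ[ j ∈ Fin _ ] (toℕ j < i × PathEdge (P j) u v) }

HamiltonianAll : ∀ {n} → Graph n → List (Fin n) → Set
HamiltonianAll H C = (∀ w → w ∈ C) × (∀ u v → E (full H) u v ⇔ CycEdge C u v)

EarDecomposition : ∀ {n} → Graph n → List (Fin n) → Set
EarDecomposition {n} H C =
  Σ[ k ∈ ℕ ] Σ[ P ∈ (Fin k → List (Fin n)) ] Σ[ a ∈ (Fin k → Fin n) ] Σ[ b ∈ (Fin k → Fin n) ]
    ( 1 ≤ k
    × (∀ (j : Fin k) → IsPath (full H) (P j) × 3 ≤ length (P j) × Ends (P j) (a j) (b j) × a j ≢ b j)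
    × (∀ u v → E (full H) u v ⇔ (CycEdge C u v ⊎ Σ[ j ∈ Fin k ] PathEdge (P j) u v))
    × (∀ u v (j : Fin k) → ¬ (CycEdge C u v × PathEdge (P j) u v))
    × (∀ u v (i j : Fin k) → i ≢ j → ¬ (PathEdge (P i) u v × PathEdge (P j) u v))
    × (∀ (j : Fin k) (w : Fin n) → (w ∈ P j × V (F C P (toℕ j)) w) ⇔ (w ≡ a j ⊎ w ≡ b j))
    × (∀ (j : Fin k) → NonChorded (F C P (suc (toℕ j))) × Biconnected (F C P (suc (toℕ j))))
    × (∀ w → V (F C P k) w)
    × (∀ u v → E (full H) u v ⇔ E (F C P k) u v) )

module Submission where

-- Ears are added greedily, keeping as invariant the fan property: from every
-- vertex there are two walks to any two other vertices that share only their
-- start.  A cycle has it, and it survives adding an edge between two present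
-- vertices and subdividing that edge by new vertices, i.e. adding an ear; it
-- makes every stage biconnected, and every stage is non-chorded as a subgraph
-- of H.  While a vertex w of H is missing, biconnectivity of H gives a path
-- through w whose ends are distinct present vertices and whose inner vertices
-- are new: the next ear, with at least two edges.  Once every vertex is
-- present, so is every edge of H, because a missing edge uv would be a chord
-- of the cycle formed by u, one of its present neighbours and a fan at v.

open import Defs

open import Data.Bool using (true)
open import Data.Empty using (⊥; ⊥-elim)
open import Data.Fin using (Fin; toℕ; zero; suc; _≟_)
open import Data.Fin.Properties using (toℕ-injective)
open import Data.List using (List; []; _∷_; _++_; [_]; length; filter; allFin; take; lookup)
open import Data.List.Properties using (filter-notAll; take-all)
open import Data.List.Membership.Propositional using (_∈_; _∉_)
open import Data.List.Membership.Propositional.Properties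
  using (∈-++⁻; ∈-++⁺ˡ; ∈-++⁺ʳ; ∈-length; ∈-filter⁺; ∈-allFin)
import Data.List.Membership.DecPropositional as DecMembership
open import Data.List.Relation.Binary.Disjoint.Propositional using (Disjoint)
open import Data.List.Relation.Binary.Subset.Propositional using (_⊆_)
open import Data.List.Relation.Unary.All using (All; []; _∷_)
import Data.List.Relation.Unary.All as All
open import Data.List.Relation.Unary.All.Properties using (¬Any⇒All¬)
open import Data.List.Relation.Unary.AllPairs using ([]; _∷_)
open import Data.List.Relation.Unary.Any using (Any; here; there; any?)
import Data.List.Relation.Unary.Any as Any
open import Data.List.Relation.Unary.Linked using (Linked; []; [-]; _∷_)
import Data.List.Relation.Unary.Linked as Linked
open import Data.List.Relation.Unary.Unique.Propositional using (Unique)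
open import Data.List.Relation.Unary.Unique.Propositional.Properties using (Unique[x∷xs]⇒x∉xs)
open import Data.Nat using (ℕ; zero; suc; _≤_; _<_; s≤s; z≤n; s≤s⁻¹)
open import Data.Nat.Properties using (≤-trans; ≤-refl; n≤1+n; <-cmp)
open import Data.Product using (Σ-syntax; _×_; _,_; proj₁; proj₂)
open import Data.Sum using (_⊎_; inj₁; inj₂; swap; [_,_]′)
open import Data.Unit using (⊤; tt)
open import Function using (_∘_)
open import Function.Bundles using (_⇔_; mk⇔; Equivalence)
open import Relation.Binary.Definitions using (DecidableEquality; tri<; tri≈; tri>)
open import Relation.Binary.PropositionalEquality using (_≡_; _≢_; refl; sym; trans; cong; subst)
open import Relation.Nullary using (¬_; Dec; yes; no; ¬?)
open import Relation.Nullary.Decidable using (_⊎-dec_; _×-dec_)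
open import Relation.Unary using (Decidable)

Unique-∷ : ∀ {A : Set} {x : A} {xs} → x ∉ xs → Unique xs → Unique (x ∷ xs)
Unique-∷ {xs = xs} x∉xs u = ¬Any⇒All¬ xs x∉xs ∷ u

∉⇒All≢ : ∀ {A : Set} {x : A} {xs} → x ∉ xs → All (_≢ x) xs
∉⇒All≢ {xs = xs} x∉xs = All.map (λ x≢w w≡x → x≢w (sym w≡x)) (¬Any⇒All¬ xs x∉xs)

Unique-tail : ∀ {A : Set} {x : A} {xs} → Unique (x ∷ xs) → Unique xs
Unique-tail (_ ∷ u) = u

∈-∷ʳ⁻ : ∀ {A : Set} {w y : A} xs → w ∈ xs ++ [ y ] → w ∈ xs ⊎ w ≡ y
∈-∷ʳ⁻ xs m with ∈-++⁻ xs m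
... | inj₁ m′ = inj₁ m′
... | inj₂ (here p) = inj₂ p

∈-∷ʳ⁺ : ∀ {A : Set} {y : A} xs → y ∈ xs ++ [ y ]
∈-∷ʳ⁺ xs = ∈-++⁺ʳ xs (here refl)

Unique[xs∷ʳx]⇒x∉xs : ∀ {A : Set} {y : A} xs → Unique (xs ++ [ y ]) → y ∉ xs
Unique[xs∷ʳx]⇒x∉xs (x ∷ xs) u (here refl) = Unique[x∷xs]⇒x∉xs u (∈-∷ʳ⁺ xs)
Unique[xs∷ʳx]⇒x∉xs (x ∷ xs) u (there m) = Unique[xs∷ʳx]⇒x∉xs xs (Unique-tail u) m

nonempty-∈ : ∀ {A : Set} (xs : List A) → 1 ≤ length xs → Σ[ x ∈ A ] x ∈ xs
nonempty-∈ (x ∷ _) _ = x , here refl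

MeetAt : ∀ {A : Set} → List A → List A → A → Set
MeetAt xs ys v = ∀ {w} → w ∈ xs → w ∈ ys → w ≡ v

-- Walks

infixr 5 _∷⟨_⟩_

data Walk {A : Set} (R : A → A → Set) : A → A → Set where
  stop   : ∀ x → Walk R x x
  _∷⟨_⟩_ : ∀ x {y z} → R x y → Walk R y z → Walk R x z

module _ {A : Set} {R : A → A → Set} where

  vertices : ∀ {x y} → Walk R x y → List A
  vertices (stop x) = [ x ]
  vertices (x ∷⟨ _ ⟩ W) = x ∷ vertices W

  start∈ : ∀ {x y} (W : Walk R x y) → x ∈ vertices W
  start∈ (stop x) = here refl
  start∈ (x ∷⟨ _ ⟩ W) = here refl

  end∈ : ∀ {x y} (W : Walk R x y) → y ∈ vertices W
  end∈ (stop x) = here refl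
  end∈ (x ∷⟨ _ ⟩ W) = there (end∈ W)

  stays-in : ∀ {V : A → Set} → (∀ {u v} → R u v → V v) →
             ∀ {x y} → V x → (W : Walk R x y) → All V (vertices W)
  stays-in R⇒V Vx (stop x) = Vx ∷ []
  stays-in R⇒V Vx (x ∷⟨ e ⟩ W) = Vx ∷ stays-in R⇒V (R⇒V e) W

  infixr 5 _++ʷ_

  _++ʷ_ : ∀ {x y z} → Walk R x y → Walk R y z → Walk R x z
  stop _ ++ʷ W′ = W′
  (x ∷⟨ e ⟩ W) ++ʷ W′ = x ∷⟨ e ⟩ (W ++ʷ W′)

  ∈-++ʷ⁻ : ∀ {x y z w} (W : Walk R x y) (W′ : Walk R y z) →
           w ∈ vertices (W ++ʷ W′) → w ∈ vertices W ⊎ w ∈ vertices W′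
  ∈-++ʷ⁻ (stop _) W′ m = inj₂ m
  ∈-++ʷ⁻ (x ∷⟨ e ⟩ W) W′ (here p) = inj₁ (here p)
  ∈-++ʷ⁻ (x ∷⟨ e ⟩ W) W′ (there m) with ∈-++ʷ⁻ W W′ m
  ... | inj₁ m′ = inj₁ (there m′)
  ... | inj₂ m′ = inj₂ m′

  ∈-++ʷ⁺ˡ : ∀ {x y z} (W : Walk R x y) (W′ : Walk R y z) → vertices W ⊆ vertices (W ++ʷ W′)
  ∈-++ʷ⁺ˡ (stop _) W′ (here refl) = start∈ W′
  ∈-++ʷ⁺ˡ (x ∷⟨ e ⟩ W) W′ (here p) = here p
  ∈-++ʷ⁺ˡ (x ∷⟨ e ⟩ W) W′ (there m) = there (∈-++ʷ⁺ˡ W W′ m)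

  ∈-++ʷ⁺ʳ : ∀ {x y z} (W : Walk R x y) (W′ : Walk R y z) → vertices W′ ⊆ vertices (W ++ʷ W′)
  ∈-++ʷ⁺ʳ (stop _) W′ m = m
  ∈-++ʷ⁺ʳ (x ∷⟨ e ⟩ W) W′ m = there (∈-++ʷ⁺ʳ W W′ m)

  ++ʷ-unique : ∀ {x y z} (W : Walk R x y) (W′ : Walk R y z) →
               Unique (vertices W) → Unique (vertices W′) → MeetAt (vertices W) (vertices W′) y →
               Unique (vertices (W ++ʷ W′))
  ++ʷ-unique (stop _) W′ _ u′ _ = u′
  ++ʷ-unique (x ∷⟨ e ⟩ W) W′ u u′ meet =
    Unique-∷ x∉ (++ʷ-unique W W′ (Unique-tail u) u′ (λ p q → meet (there p) q))
    where
    x∉ : x ∉ vertices (W ++ʷ W′)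
    x∉ m with ∈-++ʷ⁻ W W′ m
    ... | inj₁ mW = Unique[x∷xs]⇒x∉xs u mW
    ... | inj₂ mW′ = Unique[x∷xs]⇒x∉xs u (subst (_∈ vertices W) (sym (meet (here refl) mW′)) (end∈ W))

  module _ (sym-R : ∀ {u v} → R u v → R v u) where

    reverseʷ : ∀ {x y} → Walk R x y → Walk R y x
    reverseʷ (stop x) = stop x
    reverseʷ (x ∷⟨ e ⟩ W) = reverseʷ W ++ʷ (_ ∷⟨ sym-R e ⟩ stop x)

    ∈-reverseʷ⁻ : ∀ {x y} (W : Walk R x y) → vertices (reverseʷ W) ⊆ vertices W
    ∈-reverseʷ⁻ (stop x) m = m
    ∈-reverseʷ⁻ (x ∷⟨ e ⟩ W) m with ∈-++ʷ⁻ (reverseʷ W) (_ ∷⟨ sym-R e ⟩ stop x) m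
    ... | inj₁ m′ = there (∈-reverseʷ⁻ W m′)
    ... | inj₂ (here refl) = there (start∈ W)
    ... | inj₂ (there (here p)) = here p

    reverseʷ-unique : ∀ {x y} (W : Walk R x y) → Unique (vertices W) → Unique (vertices (reverseʷ W))
    reverseʷ-unique (stop x) u = u
    reverseʷ-unique (x ∷⟨ e ⟩ W) u =
      ++ʷ-unique (reverseʷ W) (_ ∷⟨ sym-R e ⟩ stop x) (reverseʷ-unique W (Unique-tail u))
        (Unique-∷ (λ { (here refl) → x∉W (start∈ W) }) (Unique-∷ (λ ()) []))
        (λ { m (here p) → p ; m (there (here refl)) → ⊥-elim (x∉W (∈-reverseʷ⁻ W m)) })
      where x∉W = Unique[x∷xs]⇒x∉xs u

  suffix : ∀ {x y w} (W : Walk R x y) → w ∈ vertices W → Walk R w y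
  suffix (stop x) (here refl) = stop x
  suffix (x ∷⟨ e ⟩ W) (here refl) = x ∷⟨ e ⟩ W
  suffix (x ∷⟨ e ⟩ W) (there m) = suffix W m

  suffix-⊆ : ∀ {x y w} (W : Walk R x y) (m : w ∈ vertices W) → vertices (suffix W m) ⊆ vertices W
  suffix-⊆ (stop x) (here refl) m′ = m′
  suffix-⊆ (x ∷⟨ e ⟩ W) (here refl) m′ = m′
  suffix-⊆ (x ∷⟨ e ⟩ W) (there m) m′ = there (suffix-⊆ W m m′)

  suffix-unique : ∀ {x y w} (W : Walk R x y) (m : w ∈ vertices W) →
                  Unique (vertices W) → Unique (vertices (suffix W m))
  suffix-unique (stop x) (here refl) u = u
  suffix-unique (x ∷⟨ e ⟩ W) (here refl) u = u
  suffix-unique (x ∷⟨ e ⟩ W) (there m) u = suffix-unique W m (Unique-tail u)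

  suffix-∌start : ∀ {x y w} (W : Walk R x y) (m : w ∈ vertices W) →
                  Unique (vertices W) → w ≢ x → x ∉ vertices (suffix W m)
  suffix-∌start (stop x) (here refl) _ w≢x = ⊥-elim (w≢x refl)
  suffix-∌start (x ∷⟨ e ⟩ W) (here refl) _ w≢x = ⊥-elim (w≢x refl)
  suffix-∌start (x ∷⟨ e ⟩ W) (there m) u _ m′ = Unique[x∷xs]⇒x∉xs u (suffix-⊆ W m m′)

  record FirstHit (S : A → Set) {x y} (W : Walk R x y) : Set where
    constructor firstHit
    field
      hit           : A
      prefix        : Walk R x hit
      hit∈S         : S hit
      first         : ∀ {u} → u ∈ vertices prefix → S u → u ≡ hit
      prefix-⊆      : vertices prefix ⊆ vertices W
      prefix-unique : Unique (vertices W) → Unique (vertices prefix)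

  first-hit : ∀ {S : A → Set} → Decidable S → ∀ {x y} (W : Walk R x y) → S y → FirstHit S W
  first-hit S? (stop x) Sx =
    firstHit x (stop x) Sx (λ { (here p) _ → p }) (λ m → m) (λ u → u)
  first-hit S? (x ∷⟨ e ⟩ W) Sy with S? x
  ... | yes Sx = firstHit x (stop x) Sx (λ { (here p) _ → p }) (λ { (here p) → here p })
                   (λ _ → Unique-∷ (λ ()) [])
  ... | no ¬Sx with first-hit S? W Sy
  ... | firstHit s P Ss fst P⊆ P-unique = firstHit s (x ∷⟨ e ⟩ P) Ss
      (λ { (here refl) Sx → ⊥-elim (¬Sx Sx) ; (there m) Su → fst m Su })
      (λ { (here p) → here p ; (there m) → there (P⊆ m) })
      (λ u → Unique-∷ (λ m → Unique[x∷xs]⇒x∉xs u (P⊆ m)) (P-unique (Unique-tail u)))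

  module _ (_≟_ : DecidableEquality A) where
    open DecMembership _≟_ using (_∈?_)

    shortcut : ∀ {x y} (W : Walk R x y) →
               Σ[ P ∈ Walk R x y ] (Unique (vertices P) × vertices P ⊆ vertices W)
    shortcut (stop x) = stop x , Unique-∷ (λ ()) [] , (λ m → m)
    shortcut (x ∷⟨ e ⟩ W) with shortcut W
    ... | P , P-unique , P⊆ with x ∈? vertices P
    ... | yes m = suffix P m , suffix-unique P m P-unique , (λ m′ → there (P⊆ (suffix-⊆ P m m′)))
    ... | no x∉P = x ∷⟨ e ⟩ P , Unique-∷ x∉P P-unique
                 , (λ { (here p) → here p ; (there m) → there (P⊆ m) })

  vertices-linked : ∀ {x y} (W : Walk R x y) → Linked R (vertices W)
  vertices-linked (stop x) = [-]
  vertices-linked (x ∷⟨ e ⟩ stop _) = e ∷ [-]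
  vertices-linked (x ∷⟨ e ⟩ W@(_ ∷⟨ _ ⟩ _)) = e ∷ vertices-linked W

  vertices-length : ∀ {x y} (W : Walk R x y) → x ≢ y → 2 ≤ length (vertices W)
  vertices-length (stop x) x≢y = ⊥-elim (x≢y refl)
  vertices-length (x ∷⟨ e ⟩ stop _) _ = s≤s (s≤s z≤n)
  vertices-length (x ∷⟨ e ⟩ _ ∷⟨ _ ⟩ _) _ = s≤s (s≤s z≤n)

  vertices-∷ʳ : ∀ {x y z} (W : Walk R x y) (e : R y z) →
                vertices (W ++ʷ (y ∷⟨ e ⟩ stop z)) ≡ vertices W ++ [ z ]
  vertices-∷ʳ (stop _) e = refl
  vertices-∷ʳ (x ∷⟨ e′ ⟩ W) e = cong (x ∷_) (vertices-∷ʳ W e)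

  init-vertices : ∀ {x y} → Walk R x y → List A
  init-vertices (stop x) = []
  init-vertices (x ∷⟨ _ ⟩ W) = x ∷ init-vertices W

  vertices≡init∷ʳend : ∀ {x y} (W : Walk R x y) → vertices W ≡ init-vertices W ++ [ y ]
  vertices≡init∷ʳend (stop x) = refl
  vertices≡init∷ʳend (x ∷⟨ _ ⟩ W) = cong (x ∷_) (vertices≡init∷ʳend W)

  uncons : ∀ {x y} (W : Walk R x y) → x ≢ y →
           Σ[ z ∈ A ] (R x z × Σ[ W′ ∈ Walk R z y ] (vertices W ≡ x ∷ vertices W′))
  uncons (stop x) x≢y = ⊥-elim (x≢y refl)
  uncons (x ∷⟨ e ⟩ W) _ = _ , e , W , refl

mapʷ : ∀ {A : Set} {R R′ : A → A → Set} → (∀ {u v} → R u v → R′ u v) →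
       ∀ {x y} → Walk R x y → Walk R′ x y
mapʷ f (stop x) = stop x
mapʷ f (x ∷⟨ e ⟩ W) = x ∷⟨ f e ⟩ mapʷ f W

vertices-mapʷ : ∀ {A : Set} {R R′ : A → A → Set} (f : ∀ {u v} → R u v → R′ u v) {x y} (W : Walk R x y) →
                vertices (mapʷ f W) ≡ vertices W
vertices-mapʷ f (stop x) = refl
vertices-mapʷ f (x ∷⟨ e ⟩ W) = cong (x ∷_) (vertices-mapʷ f W)

restrict : ∀ {A : Set} {R : A → A → Set} {Q : A → Set} {x y} (W : Walk R x y) → All Q (vertices W) →
           Σ[ W′ ∈ Walk (λ u v → R u v × Q u × Q v) x y ] (vertices W′ ≡ vertices W)
restrict (stop x) _ = stop x , refl
restrict (x ∷⟨ e ⟩ W) (Qx ∷ QW) with restrict W QW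
... | W′ , eq = x ∷⟨ e , Qx , All.lookup QW (start∈ W) ⟩ W′ , cong (x ∷_) eq

module _ {n : ℕ} {R : Fin n → Fin n → Set} where

  vertices-ends : ∀ {x y} (W : Walk R x y) → Ends (vertices W) x y
  vertices-ends (stop x) = refl , refl
  vertices-ends (x ∷⟨ e ⟩ W) = refl , last-vertex W
    where
    last-vertex : ∀ {a x y} (W : Walk R x y) → last′ a (vertices W) ≡ y
    last-vertex (stop x) = refl
    last-vertex (x ∷⟨ e ⟩ W) = last-vertex W

  fromLinked : ∀ x xs → Linked R (x ∷ xs) → Σ[ W ∈ Walk R x (last′ x xs) ] (vertices W ≡ x ∷ xs)
  fromLinked x [] _ = stop x , refl
  fromLinked x (y ∷ ys) (e ∷ l) with fromLinked y ys l
  ... | W , eq = x ∷⟨ e ⟩ W , cong (x ∷_) eq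

Fork : ∀ {n} → (Fin n → Fin n → Set) → Fin n → Fin n → Fin n → Set
Fork E y c d = Σ[ A ∈ Walk E y c ] Σ[ B ∈ Walk E y d ] MeetAt (vertices A) (vertices B) y

Fan : ∀ {n} → (Fin n → Set) → (Fin n → Fin n → Set) → Set
Fan V E = ∀ y c d → V y → V c → V d → c ≢ d → Fork E y c d

Fork-swap : ∀ {n} {E : Fin n → Fin n → Set} {y c d} → Fork E y c d → Fork E y d c
Fork-swap (A , B , meet) = B , A , λ b a → meet a b

Fan-mono : ∀ {n} {V V′ : Fin n → Set} {E E′ : Fin n → Fin n → Set} →
           (∀ {w} → V′ w → V w) → (∀ {u v} → E u v → E′ u v) → Fan V E → Fan V′ E′
Fan-mono V′⊆V E⊆E′ fan y c d Vy Vc Vd c≢d with fan y c d (V′⊆V Vy) (V′⊆V Vc) (V′⊆V Vd) c≢d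
... | A , B , meet = mapʷ E⊆E′ A , mapʷ E⊆E′ B ,
  λ a b → meet (subst (_ ∈_) (vertices-mapʷ E⊆E′ A) a) (subst (_ ∈_) (vertices-mapʷ E⊆E′ B) b)

module Linkage {n : ℕ} {V : Fin n → Set} {E : Fin n → Fin n → Set}
  (sym-E : ∀ {u v} → E u v → E v u) (fan : Fan V E) where

  open DecMembership (_≟_ {n}) using (_∈?_)

  connect : ∀ {u v} → V u → V v → Walk E u v
  connect {u} {v} Vu Vv with u ≟ v
  ... | yes refl = stop u
  ... | no u≢v = proj₁ (proj₂ (fan u u v Vu Vu Vv u≢v))

  DisjointLinkage : Fin n → Fin n → Fin n → Fin n → Set
  DisjointLinkage p q c d =
      (Σ[ A ∈ Walk E p c ] Σ[ B ∈ Walk E q d ] Disjoint (vertices A) (vertices B))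
    ⊎ (Σ[ A ∈ Walk E p d ] Σ[ B ∈ Walk E q c ] Disjoint (vertices A) (vertices B))

  DisjointLinkage-swap : ∀ {p q c d} → DisjointLinkage q p c d → DisjointLinkage p q c d
  DisjointLinkage-swap (inj₁ (A , B , dj)) = inj₂ (B , A , λ (b , a) → dj (a , b))
  DisjointLinkage-swap (inj₂ (A , B , dj)) = inj₁ (B , A , λ (b , a) → dj (a , b))

  -- D enters the fork A ∪ B at s ∈ A: go from p back along A to s and then
  -- along D to d, while q returns to c along B.
  reroute : ∀ {c p q d s} (A : Walk E c p) (B : Walk E c q) →
            Unique (vertices A) → MeetAt (vertices A) (vertices B) c →
            (D : Walk E d s) → MeetAt (vertices D) (vertices B) s →
            (s∈A : s ∈ vertices A) → s ≢ c → DisjointLinkage p q c d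
  reroute {p = p} {s = s} A B uA meet D D∩B s∈A s≢c =
    inj₂ (reverseʷ sym-E (D ++ʷ A′) , reverseʷ sym-E B , disjoint)
    where
    A′ : Walk E s p
    A′ = suffix A s∈A
    disjoint : Disjoint (vertices (reverseʷ sym-E (D ++ʷ A′))) (vertices (reverseʷ sym-E B))
    disjoint (w∈DA′ , w∈B′) with ∈-reverseʷ⁻ sym-E B w∈B′
                               | ∈-++ʷ⁻ D A′ (∈-reverseʷ⁻ sym-E (D ++ʷ A′) w∈DA′)
    ... | w∈B | inj₁ w∈D with refl ← D∩B w∈D w∈B = s≢c (meet s∈A w∈B)
    ... | w∈B | inj₂ w∈A′ with refl ← meet (suffix-⊆ A s∈A w∈A′) w∈B =
      suffix-∌start A s∈A uA s≢c w∈A′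

  module _ {c p q} (A : Walk E c p) (B : Walk E c q)
           (uA : Unique (vertices A)) (uB : Unique (vertices B))
           (meet : MeetAt (vertices A) (vertices B) c) where

    OnFork : Fin n → Set
    OnFork w = w ∈ vertices A ⊎ w ∈ vertices B

    OnFork? : Decidable OnFork
    OnFork? w = (w ∈? vertices A) ⊎-dec (w ∈? vertices B)

    reroute-at : ∀ {d s} (D : Walk E d s) → OnFork s →
                 (∀ {u} → u ∈ vertices D → OnFork u → u ≡ s) → s ≢ c → DisjointLinkage p q c d
    reroute-at D (inj₁ s∈A) first s≢c =
      reroute A B uA meet D (λ u∈D u∈B → first u∈D (inj₂ u∈B)) s∈A s≢c
    reroute-at D (inj₂ s∈B) first s≢c = DisjointLinkage-swap
      (reroute B A uB (λ b a → meet a b) D (λ u∈D u∈A → first u∈D (inj₁ u∈A)) s∈B s≢c)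

    -- A fork from d to p and q must enter A ∪ B away from c along one of its
    -- branches, since both branches cannot pass through c ≠ d.
    linkage-from-fork : ∀ {d} → Fork E d p q → c ≢ d → DisjointLinkage p q c d
    linkage-from-fork (A′ , B′ , meet′) c≢d with first-hit OnFork? A′ (inj₁ (end∈ A))
    ... | firstHit s D₁ s∈ first₁ D₁⊆ _ with s ≟ c
    ... | no s≢c = reroute-at D₁ s∈ first₁ s≢c
    ... | yes refl with first-hit OnFork? B′ (inj₂ (end∈ B))
    ... | firstHit t D₂ t∈ first₂ D₂⊆ _ with t ≟ c
    ... | no t≢c = reroute-at D₂ t∈ first₂ t≢c
    ... | yes refl = ⊥-elim (c≢d (meet′ (D₁⊆ (end∈ D₁)) (D₂⊆ (end∈ D₂))))

  linkage : ∀ {p q c d} → V p → V q → V c → V d → p ≢ q → c ≢ d → DisjointLinkage p q c d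
  linkage {p} {q} {c} {d} Vp Vq Vc Vd p≢q c≢d with fan c p q Vc Vp Vq p≢q
  ... | A₀ , B₀ , meet₀ with shortcut _≟_ A₀ | shortcut _≟_ B₀
  ... | A , uA , A⊆ | B , uB , B⊆ =
    linkage-from-fork A B uA uB (λ a b → meet₀ (A⊆ a) (B⊆ b)) (fan d p q Vd Vp Vq p≢q) c≢d

Joins : ∀ {n} → Fin n → Fin n → Fin n → Fin n → Set
Joins a b u v = (u ≡ a × v ≡ b) ⊎ (u ≡ b × v ≡ a)

Joins? : ∀ {n} (a b u v : Fin n) → Dec (Joins a b u v)
Joins? a b u v = (u ≟ a ×-dec v ≟ b) ⊎-dec (u ≟ b ×-dec v ≟ a)

-- G′ arises from G by replacing the edge ab, if present, with a path a z b
-- through a new vertex z.  The third vertex x of G lets a reach b without ab.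
module Subdivision {n : ℕ}
  {V : Fin n → Set} {E : Fin n → Fin n → Set}
  (sym-E : ∀ {u v} → E u v → E v u) (E⇒V : ∀ {u v} → E u v → V v) (fan : Fan V E)
  {V′ : Fin n → Set} {E′ : Fin n → Fin n → Set} (sym-E′ : ∀ {u v} → E′ u v → E′ v u)
  {a b z x : Fin n} (a≢b : a ≢ b) (Va : V a) (Vb : V b) (z∉V : ¬ V z)
  (Vx : V x) (x≢a : x ≢ a) (x≢b : x ≢ b)
  (V′⊆ : ∀ {w} → V′ w → V w ⊎ w ≡ z)
  (E⊆ : ∀ {u v} → E u v → ¬ Joins a b u v → E′ u v)
  (az : E′ a z) (zb : E′ z b) where

  open Linkage sym-E fan

  lift-edge : ∀ {u v} → E u v → Walk E′ u v
  lift-edge {u} {v} e with Joins? a b u v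
  ... | yes (inj₁ (refl , refl)) = a ∷⟨ az ⟩ z ∷⟨ zb ⟩ stop b
  ... | yes (inj₂ (refl , refl)) = b ∷⟨ sym-E′ zb ⟩ z ∷⟨ sym-E′ az ⟩ stop a
  ... | no ¬ab = u ∷⟨ E⊆ e ¬ab ⟩ stop v

  ∈-lift-edge⁻ : ∀ {u v w} (e : E u v) → w ∈ vertices (lift-edge e) →
                 (w ≡ u ⊎ w ≡ v) ⊎ (w ≡ z × Joins a b u v)
  ∈-lift-edge⁻ {u} {v} e m with Joins? a b u v
  ∈-lift-edge⁻ e m | yes (inj₁ (refl , refl)) with m
  ... | here p = inj₁ (inj₁ p)
  ... | there (here p) = inj₂ (p , inj₁ (refl , refl))
  ... | there (there (here p)) = inj₁ (inj₂ p)
  ∈-lift-edge⁻ e m | yes (inj₂ (refl , refl)) with m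
  ... | here p = inj₁ (inj₁ p)
  ... | there (here p) = inj₂ (p , inj₂ (refl , refl))
  ... | there (there (here p)) = inj₁ (inj₂ p)
  ∈-lift-edge⁻ e m | no _ with m
  ... | here p = inj₁ (inj₁ p)
  ... | there (here p) = inj₁ (inj₂ p)

  lift : ∀ {u v} → Walk E u v → Walk E′ u v
  lift (stop w) = stop w
  lift (_ ∷⟨ e ⟩ W) = lift-edge e ++ʷ lift W

  ∈-lift⁻ : ∀ {u v w} (W : Walk E u v) → w ∈ vertices (lift W) →
            w ∈ vertices W ⊎ (w ≡ z × a ∈ vertices W × b ∈ vertices W)
  ∈-lift⁻ (stop _) m = inj₁ m
  ∈-lift⁻ (u ∷⟨ e ⟩ W) m with ∈-++ʷ⁻ (lift-edge e) (lift W) m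
  ... | inj₂ m′ with ∈-lift⁻ W m′
  ...   | inj₁ w∈W = inj₁ (there w∈W)
  ...   | inj₂ (p , a∈W , b∈W) = inj₂ (p , there a∈W , there b∈W)
  ∈-lift⁻ (u ∷⟨ e ⟩ W) m | inj₁ m′ with ∈-lift-edge⁻ e m′
  ... | inj₁ (inj₁ p) = inj₁ (here p)
  ... | inj₁ (inj₂ refl) = inj₁ (there (start∈ W))
  ... | inj₂ (p , inj₁ (refl , refl)) = inj₂ (p , here refl , there (start∈ W))
  ... | inj₂ (p , inj₂ (refl , refl)) = inj₂ (p , there (start∈ W) , here refl)

  z∉walk : ∀ {u v} → V u → (W : Walk E u v) → z ∉ vertices W
  z∉walk Vu W m = z∉V (All.lookup (stays-in E⇒V Vu W) m)

  z∉lift : ∀ {u v} → V u → (W : Walk E u v) → a ∉ vertices W ⊎ b ∉ vertices W → z ∉ vertices (lift W)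
  z∉lift Vu W a∉⊎b∉ m with ∈-lift⁻ W m | a∉⊎b∉
  ... | inj₁ z∈W | _ = z∉walk Vu W z∈W
  ... | inj₂ (_ , a∈W , _) | inj₁ a∉W = a∉W a∈W
  ... | inj₂ (_ , _ , b∈W) | inj₂ b∉W = b∉W b∈W

  lift-fork : ∀ {y c d} → V y → Fork E y c d → Fork E′ y c d
  lift-fork Vy (A , B , meet) = lift A , lift B , meet′
    where
    meet′ : MeetAt (vertices (lift A)) (vertices (lift B)) _
    meet′ mA mB with ∈-lift⁻ A mA | ∈-lift⁻ B mB
    ... | inj₁ p | inj₁ q = meet p q
    ... | inj₁ p | inj₂ (refl , _) = ⊥-elim (z∉walk Vy A p)
    ... | inj₂ (refl , _) | inj₁ q = ⊥-elim (z∉walk Vy B q)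
    ... | inj₂ (_ , a∈A , b∈A) | inj₂ (_ , a∈B , b∈B) =
      ⊥-elim (a≢b (trans (meet a∈A a∈B) (sym (meet b∈A b∈B))))

  module ForkToZ {α β : Fin n} (Vα : V α) (Vβ : V β) (α≢β : α ≢ β) (αz : E′ α z)
    (x≢α : x ≢ α) (x≢β : x ≢ β)
    (z∉lift′ : ∀ {u v} → V u → (W : Walk E u v) →
               α ∉ vertices W ⊎ β ∉ vertices W → z ∉ vertices (lift W))
    where

    direct : ∀ {d} (B : Walk E′ α d) → z ∉ vertices B → Fork E′ α z d
    direct B z∉B = α ∷⟨ αz ⟩ stop z , B , λ { (here p) _ → p ; (there (here refl)) m → ⊥-elim (z∉B m) }

    fork-α-β : Fork E′ α z β
    fork-α-β with fan x α β Vx Vα Vβ α≢β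
    ... | X₁ , X₂ , meet = direct (lift (reverseʷ sym-E X₁) ++ʷ lift X₂) z∉
      where
      z∉ : z ∉ vertices (lift (reverseʷ sym-E X₁) ++ʷ lift X₂)
      z∉ m with ∈-++ʷ⁻ (lift (reverseʷ sym-E X₁)) (lift X₂) m
      ... | inj₁ m₁ = z∉lift′ Vα (reverseʷ sym-E X₁)
                        (inj₂ (λ β∈ → x≢β (sym (meet (∈-reverseʷ⁻ sym-E X₁ β∈) (end∈ X₂))))) m₁
      ... | inj₂ m₂ = z∉lift′ Vx X₂ (inj₁ (λ α∈ → x≢α (sym (meet (end∈ X₁) α∈)))) m₂

    fork-α : ∀ {d} → V d → d ≢ β → Fork E′ α z d
    fork-α Vd d≢β with fan α _ β Vα Vd Vβ d≢β
    ... | D₁ , D₂ , meet =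
      direct (lift D₁) (z∉lift′ Vα D₁ (inj₂ (λ β∈ → α≢β (sym (meet β∈ (end∈ D₂))))))

    fork-other : ∀ {y d} → V y → V d → y ≢ α → d ≢ α → Fork E′ y z d
    fork-other {y} {d} Vy Vd y≢α d≢α with fan y α d Vy Vα Vd (λ e → d≢α (sym e))
    ... | A₀ , B₀ , meet = lift A₀ ++ʷ (α ∷⟨ αz ⟩ stop z) , lift B₀ , meet′
      where
      z∉B : z ∉ vertices (lift B₀)
      z∉B = z∉lift′ Vy B₀ (inj₁ (λ α∈ → y≢α (sym (meet (end∈ A₀) α∈))))
      meet′ : MeetAt (vertices (lift A₀ ++ʷ (α ∷⟨ αz ⟩ stop z))) (vertices (lift B₀)) y
      meet′ mA mB with ∈-lift⁻ B₀ mB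
      ... | inj₂ (refl , _) = ⊥-elim (z∉B mB)
      ... | inj₁ w∈B₀ with ∈-++ʷ⁻ (lift A₀) (α ∷⟨ αz ⟩ stop z) mA
      ...   | inj₂ (here refl) = meet (end∈ A₀) w∈B₀
      ...   | inj₂ (there (here refl)) = ⊥-elim (z∉B mB)
      ...   | inj₁ mA₀ with ∈-lift⁻ A₀ mA₀
      ...     | inj₁ w∈A₀ = meet w∈A₀ w∈B₀
      ...     | inj₂ (refl , _) = ⊥-elim (z∉B mB)

    fork-z : ∀ {y d} → V y → V d → d ≢ α → Fork E′ y z d
    fork-z {y} {d} Vy Vd d≢α with y ≟ d | y ≟ α
    ... | yes refl | _ = lift (connect Vy Vα) ++ʷ (α ∷⟨ αz ⟩ stop z) , stop y , λ { _ (here p) → p }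
    ... | no _ | no y≢α = fork-other Vy Vd y≢α d≢α
    ... | no _ | yes refl with d ≟ β
    ...   | yes refl = fork-α-β
    ...   | no d≢β = fork-α Vd d≢β

  module ViaA = ForkToZ Va Vb a≢b az x≢a x≢b z∉lift
  module ViaB = ForkToZ Vb Va (λ e → a≢b (sym e)) (sym-E′ zb) x≢b x≢a (λ Vu W h → z∉lift Vu W (swap h))

  fork-to-z : ∀ {y d} → V y → V d → Fork E′ y z d
  fork-to-z {d = d} Vy Vd with d ≟ a
  ... | no d≢a = ViaA.fork-z Vy Vd d≢a
  ... | yes refl = ViaB.fork-z Vy Vd a≢b

  fork-from-z : ∀ {c d} (A : Walk E a c) (B : Walk E b d) → Disjoint (vertices A) (vertices B) →
                Fork E′ z c d
  fork-from-z A B dj = z ∷⟨ sym-E′ az ⟩ lift A , z ∷⟨ zb ⟩ lift B , meet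
    where
    meet : MeetAt (z ∷ vertices (lift A)) (z ∷ vertices (lift B)) z
    meet (here p) _ = p
    meet (there _) (here q) = q
    meet (there p) (there q) with ∈-lift⁻ A p | ∈-lift⁻ B q
    ... | inj₁ p′ | inj₁ q′ = ⊥-elim (dj (p′ , q′))
    ... | inj₂ (_ , _ , b∈A) | _ = ⊥-elim (dj (b∈A , start∈ B))
    ... | inj₁ _ | inj₂ (_ , a∈B , _) = ⊥-elim (dj (start∈ A , a∈B))

  fork-z-self : ∀ {d} → V d → Fork E′ z z d
  fork-z-self Vd = stop z , z ∷⟨ sym-E′ az ⟩ lift (connect Va Vd) , λ { (here p) _ → p }

  subdivision-fan : Fan V′ E′
  subdivision-fan y c d V′y V′c V′d c≢d with V′⊆ V′y | V′⊆ V′c | V′⊆ V′d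
  ... | inj₁ Vy | inj₁ Vc | inj₁ Vd = lift-fork Vy (fan y c d Vy Vc Vd c≢d)
  ... | inj₁ Vy | inj₂ refl | inj₁ Vd = fork-to-z Vy Vd
  ... | inj₁ Vy | inj₁ Vc | inj₂ refl = Fork-swap (fork-to-z Vy Vc)
  ... | inj₂ refl | inj₂ refl | inj₁ Vd = fork-z-self Vd
  ... | inj₂ refl | inj₁ Vc | inj₂ refl = Fork-swap (fork-z-self Vc)
  ... | inj₂ refl | inj₁ Vc | inj₁ Vd with linkage Va Vb Vc Vd a≢b c≢d
  ...   | inj₁ (A , B , dj) = fork-from-z A B dj
  ...   | inj₂ (A , B , dj) = Fork-swap (fork-from-z A B dj)
  subdivision-fan y c d V′y V′c V′d c≢d | _ | inj₂ refl | inj₂ refl = ⊥-elim (c≢d refl)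

Joins-sym : ∀ {n} {a b u v : Fin n} → Joins a b u v → Joins a b v u
Joins-sym (inj₁ (p , q)) = inj₂ (q , p)
Joins-sym (inj₂ (p , q)) = inj₁ (q , p)

PathEdge-sym : ∀ {n} (xs : List (Fin n)) {u v} → PathEdge xs u v → PathEdge xs v u
PathEdge-sym (x ∷ y ∷ xs) (inj₁ j) = inj₁ (Joins-sym j)
PathEdge-sym (x ∷ y ∷ xs) (inj₂ e) = inj₂ (PathEdge-sym (y ∷ xs) e)

PathEdge-∈ : ∀ {n} (xs : List (Fin n)) {u v} → PathEdge xs u v → u ∈ xs × v ∈ xs
PathEdge-∈ (x ∷ y ∷ xs) (inj₁ (inj₁ (refl , refl))) = here refl , there (here refl)
PathEdge-∈ (x ∷ y ∷ xs) (inj₁ (inj₂ (refl , refl))) = there (here refl) , here refl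
PathEdge-∈ (x ∷ y ∷ xs) (inj₂ e) with PathEdge-∈ (y ∷ xs) e
... | u∈ , v∈ = there u∈ , there v∈

PathEdge? : ∀ {n} (xs : List (Fin n)) u v → Dec (PathEdge xs u v)
PathEdge? [] u v = no λ ()
PathEdge? (x ∷ []) u v = no λ ()
PathEdge? (x ∷ y ∷ xs) u v = Joins? x y u v ⊎-dec PathEdge? (y ∷ xs) u v

PathEdge-linked : ∀ {n} {R : Fin n → Fin n → Set} → (∀ {u v} → R u v → R v u) →
                  ∀ xs → Linked R xs → ∀ {u v} → PathEdge xs u v → R u v
PathEdge-linked sym-R (x ∷ y ∷ xs) (r ∷ l) (inj₁ (inj₁ (refl , refl))) = r
PathEdge-linked sym-R (x ∷ y ∷ xs) (r ∷ l) (inj₁ (inj₂ (refl , refl))) = sym-R r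
PathEdge-linked sym-R (x ∷ y ∷ xs) (r ∷ l) (inj₂ e) = PathEdge-linked sym-R (y ∷ xs) l e

PathEdge-inner : ∀ {n} (a : Fin n) zs b → 1 ≤ length zs →
                 ∀ {u v} → PathEdge (a ∷ zs ++ [ b ]) u v → u ∈ zs ⊎ v ∈ zs
PathEdge-inner a (z ∷ zs) b _ (inj₁ (inj₁ (_ , refl))) = inj₂ (here refl)
PathEdge-inner a (z ∷ zs) b _ (inj₁ (inj₂ (refl , _))) = inj₁ (here refl)
PathEdge-inner a (z ∷ []) b _ (inj₂ (inj₁ (inj₁ (refl , _)))) = inj₁ (here refl)
PathEdge-inner a (z ∷ []) b _ (inj₂ (inj₁ (inj₂ (_ , refl)))) = inj₂ (here refl)
PathEdge-inner a (z ∷ z′ ∷ zs) b _ (inj₂ e) with PathEdge-inner z (z′ ∷ zs) b (s≤s z≤n) e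
... | inj₁ m = inj₁ (there m)
... | inj₂ m = inj₂ (there m)

ear-long : ∀ {n} (a b : Fin n) zs → 1 ≤ length zs → 3 ≤ length (a ∷ zs ++ [ b ])
ear-long a b (z ∷ []) _ = s≤s (s≤s (s≤s z≤n))
ear-long a b (z ∷ z′ ∷ zs) _ = s≤s (s≤s (s≤s z≤n))

last′-∷ʳ : ∀ {n} (a b : Fin n) zs → last′ a (zs ++ [ b ]) ≡ b
last′-∷ʳ a b [] = refl
last′-∷ʳ a b (z ∷ zs) = last′-∷ʳ z b zs

IsPath-linked : ∀ {n} {G : SubGraph n} ps → IsPath G ps → Linked (E G) ps
IsPath-linked (x ∷ xs) (_ , _ , linked) = linked

-- Growing graphs by paths

emptyGraph : ∀ {n} → SubGraph n
emptyGraph = record { V = λ _ → ⊥ ; E = λ _ _ → ⊥ }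

infixl 5 _⊕_

_⊕_ : ∀ {n} → SubGraph n → List (Fin n) → SubGraph n
G ⊕ ps = record { V = λ w → V G w ⊎ w ∈ ps ; E = λ u v → E G u v ⊎ PathEdge ps u v }

HasFan : ∀ {n} → SubGraph n → Set
HasFan G = Fan (V G) (E G)

record FanGraph {n} (G : SubGraph n) : Set where
  field
    E-sym : ∀ {u v} → E G u v → E G v u
    E⇒V   : ∀ {u v} → E G u v → V G v
    fan   : HasFan G

⊕-sym : ∀ {n} (G : SubGraph n) ps → (∀ {u v} → E G u v → E G v u) →
        ∀ {u v} → E (G ⊕ ps) u v → E (G ⊕ ps) v u
⊕-sym G ps sym-G (inj₁ e) = inj₁ (sym-G e)
⊕-sym G ps sym-G (inj₂ e) = inj₂ (PathEdge-sym ps e)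

⊕-E⇒V : ∀ {n} (G : SubGraph n) ps → (∀ {u v} → E G u v → V G v) →
        ∀ {u v} → E (G ⊕ ps) u v → V (G ⊕ ps) v
⊕-E⇒V G ps E⇒V (inj₁ e) = inj₁ (E⇒V e)
⊕-E⇒V G ps E⇒V (inj₂ e) = inj₂ (proj₂ (PathEdge-∈ ps e))

subdivide-first-edge : ∀ {n} (F : SubGraph n) →
  (∀ {u v} → E F u v → E F v u) → (∀ {u v} → E F u v → V F v) →
  ∀ p r s rest → HasFan (F ⊕ (p ∷ s ∷ rest)) → ¬ V (F ⊕ (p ∷ s ∷ rest)) r → p ≢ s →
  ∀ x → V (F ⊕ (p ∷ s ∷ rest)) x → x ≢ p → x ≢ s → HasFan (F ⊕ (p ∷ r ∷ s ∷ rest))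
subdivide-first-edge F sym-F E⇒V-F p r s rest fan r∉ p≢s x Vx x≢p x≢s =
  Subdivision.subdivision-fan (⊕-sym F path sym-F) (⊕-E⇒V F path E⇒V-F) fan (⊕-sym F path′ sym-F)
    p≢s (inj₂ (here refl)) (inj₂ (there (here refl))) r∉ Vx x≢p x≢s V′⊆ E⊆
    (inj₂ (inj₁ (inj₁ (refl , refl)))) (inj₂ (inj₂ (inj₁ (inj₁ (refl , refl)))))
  where
  path path′ : List (Fin _)
  path = p ∷ s ∷ rest
  path′ = p ∷ r ∷ s ∷ rest
  V′⊆ : ∀ {w} → V (F ⊕ path′) w → V (F ⊕ path) w ⊎ w ≡ r
  V′⊆ (inj₁ v) = inj₁ (inj₁ v)
  V′⊆ (inj₂ (here q)) = inj₁ (inj₂ (here q))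
  V′⊆ (inj₂ (there (here q))) = inj₂ q
  V′⊆ (inj₂ (there (there m))) = inj₁ (inj₂ (there m))
  E⊆ : ∀ {u v} → E (F ⊕ path) u v → ¬ Joins p s u v → E (F ⊕ path′) u v
  E⊆ (inj₁ e) _ = inj₁ e
  E⊆ (inj₂ (inj₁ j)) ¬j = ⊥-elim (¬j j)
  E⊆ (inj₂ (inj₂ e)) _ = inj₂ (inj₂ (inj₂ e))

triangle-∈ : ∀ {n} {x r s w : Fin n} → w ∈ x ∷ r ∷ s ∷ x ∷ [] → w ≡ x ⊎ w ≡ r ⊎ w ≡ s
triangle-∈ (here p) = inj₁ p
triangle-∈ (there (here p)) = inj₂ (inj₁ p)
triangle-∈ (there (there (here p))) = inj₂ (inj₂ p)
triangle-∈ (there (there (there (here p)))) = inj₁ p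

triangle-edge : ∀ {n} {x r s u v : Fin n} →
                u ∈ x ∷ r ∷ s ∷ x ∷ [] → v ∈ x ∷ r ∷ s ∷ x ∷ [] → u ≢ v →
                PathEdge (x ∷ r ∷ s ∷ x ∷ []) u v
triangle-edge u∈ v∈ u≢v with triangle-∈ u∈ | triangle-∈ v∈
... | inj₁ refl | inj₁ refl = ⊥-elim (u≢v refl)
... | inj₁ refl | inj₂ (inj₁ refl) = inj₁ (inj₁ (refl , refl))
... | inj₁ refl | inj₂ (inj₂ refl) = inj₂ (inj₂ (inj₁ (inj₂ (refl , refl))))
... | inj₂ (inj₁ refl) | inj₁ refl = inj₁ (inj₂ (refl , refl))
... | inj₂ (inj₁ refl) | inj₂ (inj₁ refl) = ⊥-elim (u≢v refl)
... | inj₂ (inj₁ refl) | inj₂ (inj₂ refl) = inj₂ (inj₁ (inj₁ (refl , refl)))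
... | inj₂ (inj₂ refl) | inj₁ refl = inj₂ (inj₂ (inj₁ (inj₁ (refl , refl))))
... | inj₂ (inj₂ refl) | inj₂ (inj₁ refl) = inj₂ (inj₁ (inj₂ (refl , refl)))
... | inj₂ (inj₂ refl) | inj₂ (inj₂ refl) = ⊥-elim (u≢v refl)

triangle-fan : ∀ {n} (x r s : Fin n) → HasFan (emptyGraph ⊕ (x ∷ r ∷ s ∷ x ∷ []))
triangle-fan x r s y c d (inj₂ y∈) (inj₂ c∈) (inj₂ d∈) c≢d with y ≟ c | y ≟ d
... | yes refl | _ = stop y , y ∷⟨ inj₂ (triangle-edge y∈ d∈ c≢d) ⟩ stop d , λ { (here p) _ → p }
... | no y≢c | yes refl = y ∷⟨ inj₂ (triangle-edge y∈ c∈ y≢c) ⟩ stop c , stop y , λ { _ (here p) → p }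
... | no y≢c | no y≢d =
  y ∷⟨ inj₂ (triangle-edge y∈ c∈ y≢c) ⟩ stop c , y ∷⟨ inj₂ (triangle-edge y∈ d∈ y≢d) ⟩ stop d , meet
  where
  meet : MeetAt (y ∷ c ∷ []) (y ∷ d ∷ []) y
  meet (here p) _ = p
  meet _ (here q) = q
  meet (there (here p)) (there (here q)) = ⊥-elim (c≢d (trans (sym p) q))

-- A cycle arises from a triangle by repeatedly subdividing an edge at x.
cycle-fan : ∀ {n} (x : Fin n) zs → Unique (x ∷ zs) → 2 ≤ length zs → HasFan (emptyGraph ⊕ (x ∷ zs ++ [ x ]))
cycle-fan x (r ∷ []) u (s≤s ())
cycle-fan x (r ∷ s ∷ []) u _ = triangle-fan x r s
cycle-fan x (r ∷ s ∷ t ∷ ts) u _ =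
  subdivide-first-edge emptyGraph (λ ()) (λ ()) x r s (t ∷ ts ++ [ x ])
    (cycle-fan x (s ∷ t ∷ ts) u′ (s≤s (s≤s z≤n))) r∉ x≢s t (inj₂ (there (there (here refl)))) t≢x t≢s
  where
  u′ : Unique (x ∷ s ∷ t ∷ ts)
  u′ = Unique-∷ (λ m → Unique[x∷xs]⇒x∉xs u (there m)) (Unique-tail (Unique-tail u))
  r∉ : ¬ V (emptyGraph ⊕ (x ∷ s ∷ t ∷ ts ++ [ x ])) r
  r∉ (inj₂ (here p)) = Unique[x∷xs]⇒x∉xs u (here (sym p))
  r∉ (inj₂ (there m)) with ∈-∷ʳ⁻ (s ∷ t ∷ ts) m
  ... | inj₁ m′ = Unique[x∷xs]⇒x∉xs (Unique-tail u) m′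
  ... | inj₂ p = Unique[x∷xs]⇒x∉xs u (here (sym p))
  x≢s : x ≢ s
  x≢s e = Unique[x∷xs]⇒x∉xs u (there (here e))
  t≢x : t ≢ x
  t≢x e = Unique[x∷xs]⇒x∉xs u (there (there (here (sym e))))
  t≢s : t ≢ s
  t≢s e = Unique[x∷xs]⇒x∉xs (Unique-tail (Unique-tail u)) (here (sym e))

ThirdVertex : ∀ {n} → (Fin n → Set) → Set
ThirdVertex {n} V = ∀ p q → Σ[ x ∈ Fin n ] (V x × x ≢ p × x ≢ q)

distinct⇒ThirdVertex : ∀ {n} {V : Fin n → Set} {t₁ t₂ t₃ : Fin n} → V t₁ → V t₂ → V t₃ →
                       t₁ ≢ t₂ → t₁ ≢ t₃ → t₂ ≢ t₃ → ThirdVertex V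
distinct⇒ThirdVertex {t₁ = t₁} {t₂} {t₃} V₁ V₂ V₃ t₁≢t₂ t₁≢t₃ t₂≢t₃ p q
  with t₁ ≟ p | t₁ ≟ q | t₂ ≟ p | t₂ ≟ q
... | no t₁≢p | no t₁≢q | _ | _ = t₁ , V₁ , t₁≢p , t₁≢q
... | _ | _ | no t₂≢p | no t₂≢q = t₂ , V₂ , t₂≢p , t₂≢q
... | yes refl | _ | yes e | _ = ⊥-elim (t₁≢t₂ (sym e))
... | no _ | yes refl | _ | yes e = ⊥-elim (t₁≢t₂ (sym e))
... | yes refl | _ | no _ | yes refl = t₃ , V₃ , (λ e → t₁≢t₃ (sym e)) , (λ e → t₂≢t₃ (sym e))
... | no _ | yes refl | yes refl | no _ = t₃ , V₃ , (λ e → t₂≢t₃ (sym e)) , (λ e → t₁≢t₃ (sym e))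

-- An ear through new vertices zs is the edge pq added and then subdivided.
ear-fan : ∀ {n} (F : SubGraph n) → FanGraph F → ThirdVertex (V F) → ∀ p q zs → 1 ≤ length zs →
  Unique (p ∷ zs ++ [ q ]) → (∀ {w} → w ∈ zs → ¬ V F w) → p ≢ q → V F p → V F q →
  HasFan (F ⊕ (p ∷ zs ++ [ q ]))
ear-fan F fg third p q (r ∷ []) _ u new p≢q Vp Vq with third p q
... | x , Vx , x≢p , x≢q =
  Subdivision.subdivision-fan sym⁺ E⇒V⁺ (Fan-mono (λ v → v) inj₁ (FanGraph.fan fg)) (⊕-sym F path FE-sym)
    p≢q Vp Vq (new (here refl)) Vx x≢p x≢q V′⊆ E⊆
    (inj₂ (inj₁ (inj₁ (refl , refl)))) (inj₂ (inj₂ (inj₁ (inj₁ (refl , refl)))))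
  where
  open FanGraph fg renaming (E-sym to FE-sym; E⇒V to FE⇒V)
  path : List (Fin _)
  path = p ∷ r ∷ q ∷ []
  E⁺ : Fin _ → Fin _ → Set
  E⁺ u v = E F u v ⊎ Joins p q u v
  sym⁺ : ∀ {u v} → E⁺ u v → E⁺ v u
  sym⁺ (inj₁ e) = inj₁ (FE-sym e)
  sym⁺ (inj₂ j) = inj₂ (Joins-sym j)
  E⇒V⁺ : ∀ {u v} → E⁺ u v → V F v
  E⇒V⁺ (inj₁ e) = FE⇒V e
  E⇒V⁺ (inj₂ (inj₁ (_ , refl))) = Vq
  E⇒V⁺ (inj₂ (inj₂ (_ , refl))) = Vp
  V′⊆ : ∀ {w} → V (F ⊕ path) w → V F w ⊎ w ≡ r
  V′⊆ (inj₁ v) = inj₁ v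
  V′⊆ (inj₂ (here refl)) = inj₁ Vp
  V′⊆ (inj₂ (there (here e))) = inj₂ e
  V′⊆ (inj₂ (there (there (here refl)))) = inj₁ Vq
  E⊆ : ∀ {u v} → E⁺ u v → ¬ Joins p q u v → E (F ⊕ path) u v
  E⊆ (inj₁ e) _ = inj₁ e
  E⊆ (inj₂ j) ¬j = ⊥-elim (¬j j)
ear-fan F fg third p q (r ∷ s ∷ ss) _ u new p≢q Vp Vq =
  subdivide-first-edge F (FanGraph.E-sym fg) (FanGraph.E⇒V fg) p r s (ss ++ [ q ])
    (ear-fan F fg third p q (s ∷ ss) (s≤s z≤n) u′ (λ m → new (there m)) p≢q Vp Vq)
    r∉ p≢s q (inj₁ Vq) (λ e → p≢q (sym e)) q≢s
  where
  u′ : Unique (p ∷ s ∷ ss ++ [ q ])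
  u′ = Unique-∷ (λ m → Unique[x∷xs]⇒x∉xs u (there m)) (Unique-tail (Unique-tail u))
  r∉ : ¬ V (F ⊕ (p ∷ s ∷ ss ++ [ q ])) r
  r∉ (inj₁ v) = new (here refl) v
  r∉ (inj₂ (here refl)) = new (here refl) Vp
  r∉ (inj₂ (there m)) with ∈-∷ʳ⁻ (s ∷ ss) m
  ... | inj₁ m′ = Unique[x∷xs]⇒x∉xs (Unique-tail u) (∈-++⁺ˡ m′)
  ... | inj₂ refl = new (here refl) Vq
  p≢s : p ≢ s
  p≢s refl = new (there (here refl)) Vp
  q≢s : q ≢ s
  q≢s refl = new (there (here refl)) Vq

walk-isPath : ∀ {n} (G : SubGraph n) {u v} (W : Walk (E G) u v) →
              Unique (vertices W) → All (V G) (vertices W) → IsPath G (vertices W)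
walk-isPath G (stop x) u VW = u , VW , vertices-linked (stop x)
walk-isPath G (x ∷⟨ e ⟩ W) u VW = u , VW , vertices-linked (x ∷⟨ e ⟩ W)

walk⇒path : ∀ {n} (G : SubGraph n) {u v} (W : Walk (E G) u v) → All (V G) (vertices W) →
            Σ[ ps ∈ List (Fin n) ] (IsPath G ps × Ends ps u v)
walk⇒path G W VW with shortcut _≟_ W
... | P , uP , P⊆ = vertices P , walk-isPath G P uP (All.tabulate (λ m → All.lookup VW (P⊆ m))) , vertices-ends P

record PathWalk {n} (G : SubGraph n) (u v : Fin n) : Set where
  field
    walk   : Walk (E G) u v
    unique : Unique (vertices walk)
    inside : All (V G) (vertices walk)

connected-walk : ∀ {n} {G : SubGraph n} → Connected G → ∀ {u v} → V G u → V G v → PathWalk G u v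
connected-walk connected Vu Vv with connected _ _ Vu Vv
... | x ∷ xs , (unique , inside , linked) , refl , refl with fromLinked x xs linked
... | W , eq = record { walk = W ; unique = subst Unique (sym eq) unique ; inside = subst (All _) (sym eq) inside }

module _ {n : ℕ} {G : SubGraph n} (fg : FanGraph G) where
  open FanGraph fg
  open Linkage E-sym fan

  walk-avoiding : ∀ {u v x} → V G u → V G v → V G x → u ≢ x → v ≢ x →
                  Σ[ W ∈ Walk (E G) u v ] (x ∉ vertices W)
  walk-avoiding {u} {v} {x} Vu Vv Vx u≢x v≢x with u ≟ v
  ... | yes refl = stop u , λ { (here x≡u) → u≢x (sym x≡u) }
  ... | no _ with fan u v x Vu Vv Vx v≢x
  ... | A , B , meet = A , λ x∈A → u≢x (sym (meet x∈A (end∈ B)))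

  fan⇒biconnected : Biconnected G
  fan⇒biconnected = connected , connected-without
    where
    connected : Connected G
    connected u v Vu Vv = walk⇒path G W (stays-in E⇒V Vu W)
      where W = connect Vu Vv
    connected-without : ∀ x → V G x → Connected (G ─ x)
    connected-without x Vx u v (Vu , u≢x) (Vv , v≢x) with walk-avoiding Vu Vv Vx u≢x v≢x
    ... | W , x∉W with restrict W (∉⇒All≢ x∉W)
    ... | W′ , eq =
      walk⇒path (G ─ x) W′ (subst (All _) (sym eq) (All.zip (stays-in E⇒V Vu W , ∉⇒All≢ x∉W)))

infixl 5 _⊕*_

_⊕*_ : ∀ {n} → SubGraph n → List (List (Fin n)) → SubGraph n
G ⊕* [] = G
G ⊕* (ps ∷ es) = (G ⊕ ps) ⊕* es

V-⊕*⁻ : ∀ {n} (G : SubGraph n) es {w} → V (G ⊕* es) w → V G w ⊎ Any (w ∈_) es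
V-⊕*⁻ G [] v = inj₁ v
V-⊕*⁻ G (ps ∷ es) v with V-⊕*⁻ (G ⊕ ps) es v
... | inj₁ (inj₁ v′) = inj₁ v′
... | inj₁ (inj₂ m) = inj₂ (here m)
... | inj₂ m = inj₂ (there m)

V-⊕*⁺ : ∀ {n} (G : SubGraph n) es {w} → V G w ⊎ Any (w ∈_) es → V (G ⊕* es) w
V-⊕*⁺ G [] (inj₁ v) = v
V-⊕*⁺ G (ps ∷ es) (inj₁ v) = V-⊕*⁺ (G ⊕ ps) es (inj₁ (inj₁ v))
V-⊕*⁺ G (ps ∷ es) (inj₂ (here m)) = V-⊕*⁺ (G ⊕ ps) es (inj₁ (inj₂ m))
V-⊕*⁺ G (ps ∷ es) (inj₂ (there m)) = V-⊕*⁺ (G ⊕ ps) es (inj₂ m)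

E-⊕*⁻ : ∀ {n} (G : SubGraph n) es {u v} → E (G ⊕* es) u v → E G u v ⊎ Any (λ ps → PathEdge ps u v) es
E-⊕*⁻ G [] e = inj₁ e
E-⊕*⁻ G (ps ∷ es) e with E-⊕*⁻ (G ⊕ ps) es e
... | inj₁ (inj₁ e′) = inj₁ e′
... | inj₁ (inj₂ pe) = inj₂ (here pe)
... | inj₂ m = inj₂ (there m)

E-⊕*⁺ : ∀ {n} (G : SubGraph n) es {u v} → E G u v ⊎ Any (λ ps → PathEdge ps u v) es → E (G ⊕* es) u v
E-⊕*⁺ G [] (inj₁ e) = e
E-⊕*⁺ G (ps ∷ es) (inj₁ e) = E-⊕*⁺ (G ⊕ ps) es (inj₁ (inj₁ e))
E-⊕*⁺ G (ps ∷ es) (inj₂ (here pe)) = E-⊕*⁺ (G ⊕ ps) es (inj₁ (inj₂ pe))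
E-⊕*⁺ G (ps ∷ es) (inj₂ (there m)) = E-⊕*⁺ (G ⊕ ps) es (inj₂ m)

module _ {A : Set} {Q : A → Set} where

  Any-take⁻ : ∀ i (xs : List A) → Any Q (take i xs) → Σ[ j ∈ Fin (length xs) ] (toℕ j < i × Q (lookup xs j))
  Any-take⁻ (suc i) (x ∷ xs) (here q) = zero , s≤s z≤n , q
  Any-take⁻ (suc i) (x ∷ xs) (there m) with Any-take⁻ i xs m
  ... | j , j<i , q = suc j , s≤s j<i , q

  Any-take⁺ : ∀ i (xs : List A) → Σ[ j ∈ Fin (length xs) ] (toℕ j < i × Q (lookup xs j)) → Any Q (take i xs)
  Any-take⁺ (suc i) (x ∷ xs) (zero , _ , q) = here q
  Any-take⁺ (suc i) (x ∷ xs) (suc j , s≤s j<i , q) = there (Any-take⁺ i xs (j , j<i , q))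

-- Subgraphs of the host graph H

module Host {n : ℕ} (H : Graph n) where

  Adj : Fin n → Fin n → Set
  Adj u v = Graph.adj H u v ≡ true

  Adj-sym : ∀ {u v} → Adj u v → Adj v u
  Adj-sym {u} {v} p = trans (sym (Graph.sym H u v)) p

  Adj-irrefl : ∀ {u} → ¬ Adj u u
  Adj-irrefl {u} p with trans (sym p) (Graph.irrefl H u)
  ... | ()

  NonChorded-⊆ : (G : SubGraph n) → (∀ {u v} → E G u v → Adj u v) → NonChorded (full H) → NonChorded G
  NonChorded-⊆ G G⊆H nc (x ∷ xs) (3≤ , distinct , _ , linked) u v e u∈ v∈ =
    nc (x ∷ xs) (3≤ , distinct , All.tabulate (λ _ → tt) , Linked.map G⊆H linked) u v (G⊆H e) u∈ v∈

  closing-cycle : ∀ {R : Fin n → Fin n → Set} → (∀ {u v} → R u v → Adj u v) →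
    ∀ v {x y} (X : Walk R x y) → R v x → R y v → Unique (vertices X) → v ∉ vertices X → x ≢ y →
    IsCycle (full H) (v ∷ vertices X) × Linked R (v ∷ vertices X ++ [ v ])
  closing-cycle {R} R⊆H v X vx yv uX v∉X x≢y =
    (s≤s (vertices-length X x≢y) , Unique-∷ v∉X uX , All.tabulate (λ _ → tt) , Linked.map R⊆H linked) , linked
    where
    linked : Linked R (v ∷ vertices X ++ [ v ])
    linked = subst (Linked _) (cong (v ∷_) (vertices-∷ʳ X yv))
                   (vertices-linked (v ∷⟨ vx ⟩ X ++ʷ (_ ∷⟨ yv ⟩ stop v)))

  -- The cycle v → … → u → w → … → v formed by a fork at v towards u, w and the edge uw.
  fork-cycle : {R : Fin n → Fin n → Set} → (∀ {u v} → R u v → R v u) → (∀ {u v} → R u v → Adj u v) →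
    ∀ {v u w} (A : Walk R v u) (B : Walk R v w) → Unique (vertices A) → Unique (vertices B) →
    MeetAt (vertices A) (vertices B) v → R u w → v ≢ u → v ≢ w →
    Σ[ xs ∈ List (Fin n) ] (IsCycle (full H) (v ∷ xs) × Linked R (v ∷ xs ++ [ v ]) × u ∈ xs)
  fork-cycle sym-R R⊆H (stop _) B uA uB meet uw v≢u v≢w = ⊥-elim (v≢u refl)
  fork-cycle sym-R R⊆H A (stop _) uA uB meet uw v≢u v≢w = ⊥-elim (v≢w refl)
  fork-cycle {R} sym-R R⊆H {v} {u} (_∷⟨_⟩_ _ {a₁} va₁ A′) (_∷⟨_⟩_ _ {b₁} vb₁ B′)
             uA uB meet uw v≢u v≢w =
    vertices X , proj₁ cycle , proj₂ cycle , ∈-++ʷ⁺ʳ A′ Y (here refl)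
    where
    Y : Walk R u b₁
    Y = u ∷⟨ uw ⟩ reverseʷ sym-R B′
    X : Walk R a₁ b₁
    X = A′ ++ʷ Y
    v∉A′ : v ∉ vertices A′
    v∉A′ = Unique[x∷xs]⇒x∉xs uA
    v∉B′ : v ∉ vertices B′
    v∉B′ = Unique[x∷xs]⇒x∉xs uB
    ∈B′⇒∉A′ : ∀ {t} → t ∈ vertices B′ → t ∉ vertices A′
    ∈B′⇒∉A′ t∈B′ t∈A′ with refl ← meet (there t∈A′) (there t∈B′) = v∉A′ t∈A′
    uY : Unique (vertices Y)
    uY = Unique-∷ (λ m → ∈B′⇒∉A′ (∈-reverseʷ⁻ sym-R B′ m) (end∈ A′))
                  (reverseʷ-unique sym-R B′ (Unique-tail uB))
    uX : Unique (vertices X)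
    uX = ++ʷ-unique A′ Y (Unique-tail uA) uY
      λ { _ (here p) → p
        ; t∈A′ (there t∈B′) → ⊥-elim (∈B′⇒∉A′ (∈-reverseʷ⁻ sym-R B′ t∈B′) t∈A′) }
    v∉X : v ∉ vertices X
    v∉X m with ∈-++ʷ⁻ A′ Y m
    ... | inj₁ v∈A′ = v∉A′ v∈A′
    ... | inj₂ (here v≡u) = v≢u v≡u
    ... | inj₂ (there v∈B′) = v∉B′ (∈-reverseʷ⁻ sym-R B′ v∈B′)
    a₁≢b₁ : a₁ ≢ b₁
    a₁≢b₁ refl = ∈B′⇒∉A′ (start∈ B′) (start∈ A′)
    cycle : IsCycle (full H) (v ∷ vertices X) × Linked R (v ∷ vertices X ++ [ v ])
    cycle = closing-cycle R⊆H v X va₁ (sym-R vb₁) uX v∉X a₁≢b₁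

  -- A missing edge uv would be a chord of a fork cycle through u and v.
  module _ {G : SubGraph n} (fg : FanGraph G) where
    open FanGraph fg
    open Linkage E-sym fan

    spanning-fan-complete : (∀ u v → Dec (E G u v)) → (∀ {u v} → E G u v → Adj u v) →
      (∀ w → V G w) → NonChorded (full H) → ∀ {u v} → Adj u v → E G u v
    spanning-fan-complete E? G⊆H spans nc {u} {v} uv with E? u v
    ... | yes e = e
    ... | no ¬e with uncons (connect (spans u) (spans v)) (λ { refl → Adj-irrefl uv })
    ... | w , uw , _ with fan v u w (spans v) (spans u) (spans w) (λ { refl → Adj-irrefl (G⊆H uw) })
    ... | A₀ , B₀ , meet₀ with shortcut _≟_ A₀ | shortcut _≟_ B₀
    ... | A , uA , A⊆ | B , uB , B⊆
      with fork-cycle E-sym G⊆H A B uA uB (λ a b → meet₀ (A⊆ a) (B⊆ b)) uw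
             (λ { refl → Adj-irrefl uv }) (λ { refl → ¬e uw })
    ... | xs , cycle , linked , u∈xs = ⊥-elim (¬e (PathEdge-linked E-sym (v ∷ xs ++ [ v ]) linked
                                         (nc (v ∷ xs) cycle u v uv (there u∈xs) (here refl))))

  -- Ears

  record Ear (G : SubGraph n) : Set where
    field
      a b      : Fin n
      inner    : List (Fin n)
      unique   : Unique (a ∷ inner ++ [ b ])
      linked   : Linked Adj (a ∷ inner ++ [ b ])
      nonempty : 1 ≤ length inner
      new      : ∀ {w} → w ∈ inner → ¬ V G w
      a≢b      : a ≢ b
      Va       : V G a
      Vb       : V G b

    path : List (Fin n)
    path = a ∷ inner ++ [ b ]

  ear-of-walk : {G : SubGraph n} {a b : Fin n} (W : Walk Adj a b) → Unique (vertices W) →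
    (∀ {y} → y ∈ vertices W → V G y → y ≡ a ⊎ y ≡ b) → ∀ {z} → z ∈ vertices W → ¬ V G z →
    V G a → V G b → a ≢ b → Ear G
  ear-of-walk (stop _) _ _ _ _ _ _ a≢b = ⊥-elim (a≢b refl)
  ear-of-walk {G} {a} {b} W@(_ ∷⟨ _ ⟩ W′) uW only-ends {z} z∈W z∉G Va Vb a≢b = record
    { a = a ; b = b ; inner = inner ; unique = subst Unique eq uW
    ; linked = subst (Linked Adj) eq (vertices-linked W) ; nonempty = ∈-length z∈inner
    ; new = new ; a≢b = a≢b ; Va = Va ; Vb = Vb }
    where
    inner : List (Fin n)
    inner = init-vertices W′
    eq : vertices W ≡ a ∷ inner ++ [ b ]
    eq = cong (a ∷_) (vertices≡init∷ʳend W′)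
    inner⊆W : ∀ {y} → y ∈ inner → y ∈ vertices W
    inner⊆W {y} m = subst (y ∈_) (sym eq) (there (∈-++⁺ˡ m))
    new : ∀ {y} → y ∈ inner → ¬ V G y
    new {y} m Vy with only-ends (inner⊆W m) Vy
    ... | inj₁ refl = Unique[x∷xs]⇒x∉xs (subst Unique eq uW) (∈-++⁺ˡ m)
    ... | inj₂ refl = Unique[xs∷ʳx]⇒x∉xs inner (Unique-tail (subst Unique eq uW)) m
    z∈inner : z ∈ inner
    z∈inner with subst (z ∈_) eq z∈W
    ... | here refl = ⊥-elim (z∉G Va)
    ... | there m with ∈-∷ʳ⁻ inner m
    ...   | inj₁ m′ = m′
    ...   | inj₂ refl = ⊥-elim (z∉G Vb)

  -- From w ∉ G walk into G, reaching it first at a; from w walk to G while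
  -- avoiding a, reaching it first at b ≠ a.  Going back from a towards w until
  -- the second walk is met at z, and then along it to b, gives the ear.
  module FindEar {G : SubGraph n} (V? : Decidable (V G)) (third : ThirdVertex (V G))
    (biconnected : Biconnected (full H)) {w : Fin n} (w∉G : ¬ V G w) where
    open DecMembership (_≟_ {n}) using (_∈?_)

    t : Fin n
    t = proj₁ (third w w)

    into-G : PathWalk (full H) w t
    into-G = connected-walk (proj₁ biconnected) _ _

    hit-a : FirstHit (V G) (PathWalk.walk into-G)
    hit-a = first-hit V? (PathWalk.walk into-G) (proj₁ (proj₂ (third w w)))

    open FirstHit hit-a using () renaming
      (hit to a; prefix to Q₁; hit∈S to Va; first to first-a; prefix-unique to Q₁-unique)

    x : Fin n
    x = proj₁ (third a a)

    w≢a : w ≢ a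
    w≢a w≡a = w∉G (subst (V G) (sym w≡a) Va)

    avoiding-a : PathWalk (full H ─ a) w x
    avoiding-a = connected-walk (proj₂ biconnected a _) (_ , w≢a) (_ , proj₁ (proj₂ (proj₂ (third a a))))

    R₀ : Walk Adj w x
    R₀ = mapʷ proj₁ (PathWalk.walk avoiding-a)

    R₀≡ : vertices R₀ ≡ vertices (PathWalk.walk avoiding-a)
    R₀≡ = vertices-mapʷ proj₁ (PathWalk.walk avoiding-a)

    R₀-avoids-a : ∀ {y} → y ∈ vertices R₀ → y ≢ a
    R₀-avoids-a m = proj₂ (All.lookup (PathWalk.inside avoiding-a) (subst (_ ∈_) R₀≡ m))

    hit-b : FirstHit (V G) R₀
    hit-b = first-hit V? R₀ (proj₁ (proj₂ (third a a)))

    open FirstHit hit-b using () renaming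
      (hit to b; prefix to R₁; hit∈S to Vb; first to first-b; prefix-⊆ to R₁⊆R₀; prefix-unique to R₁-unique)

    hit-z : FirstHit (_∈ vertices R₁) (reverseʷ Adj-sym Q₁)
    hit-z = first-hit (_∈? vertices R₁) (reverseʷ Adj-sym Q₁) (start∈ R₁)

    open FirstHit hit-z using () renaming
      (hit to z; prefix to Q₂; hit∈S to z∈R₁; first to first-z; prefix-⊆ to Q₂⊆; prefix-unique to Q₂-unique)

    R₂ : Walk Adj z b
    R₂ = suffix R₁ z∈R₁

    Q₂⊆Q₁ : ∀ {y} → y ∈ vertices Q₂ → y ∈ vertices Q₁
    Q₂⊆Q₁ m = ∈-reverseʷ⁻ Adj-sym Q₁ (Q₂⊆ m)

    ear-walk-unique : Unique (vertices (Q₂ ++ʷ R₂))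
    ear-walk-unique = ++ʷ-unique Q₂ R₂
      (Q₂-unique (reverseʷ-unique Adj-sym Q₁ (Q₁-unique (PathWalk.unique into-G))))
      (suffix-unique R₁ z∈R₁ (R₁-unique (subst Unique (sym R₀≡) (PathWalk.unique avoiding-a))))
      (λ q r → first-z q (suffix-⊆ R₁ z∈R₁ r))

    ear-walk-ends : ∀ {y} → y ∈ vertices (Q₂ ++ʷ R₂) → V G y → y ≡ a ⊎ y ≡ b
    ear-walk-ends m Vy with ∈-++ʷ⁻ Q₂ R₂ m
    ... | inj₁ q = inj₁ (first-a (Q₂⊆Q₁ q) Vy)
    ... | inj₂ r = inj₂ (first-b (suffix-⊆ R₁ z∈R₁ r) Vy)

    z∉G : ¬ V G z
    z∉G Vz = R₀-avoids-a (R₁⊆R₀ z∈R₁) (first-a (Q₂⊆Q₁ (end∈ Q₂)) Vz)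

    ear : Ear G
    ear = ear-of-walk (Q₂ ++ʷ R₂) ear-walk-unique ear-walk-ends (∈-++ʷ⁺ˡ Q₂ R₂ (end∈ Q₂)) z∉G Va Vb
            (λ a≡b → R₀-avoids-a (R₁⊆R₀ (end∈ R₁)) (sym a≡b))

  record ProperEar (G : SubGraph n) (ps : List (Fin n)) : Set where
    field
      a b           : Fin n
      isPath        : IsPath (full H) ps
      long          : 3 ≤ length ps
      ends          : Ends ps a b
      a≢b           : a ≢ b
      attachment    : ∀ w → (w ∈ ps × V G w) ⇔ (w ≡ a ⊎ w ≡ b)
      edge-disjoint : ∀ {u v} → E G u v → ¬ PathEdge ps u v
      fan           : HasFan (G ⊕ ps)

  record Stage (G : SubGraph n) : Set where
    field
      fanGraph : FanGraph G
      V?       : Decidable (V G)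
      E?       : ∀ u v → Dec (E G u v)
      third    : ThirdVertex (V G)
      ⊆H       : ∀ {u v} → E G u v → Adj u v

  proper-ear : ∀ {G} → Stage G → (ear : Ear G) → ProperEar G (Ear.path ear)
  proper-ear {G} st ear = record
    { a = a ; b = b ; isPath = unique , All.tabulate (λ _ → tt) , linked ; long = ear-long a b inner nonempty
    ; ends = refl , last′-∷ʳ a b inner ; a≢b = a≢b
    ; attachment = λ w → mk⇔ (to w) (from w)
    ; edge-disjoint = edge-disjoint
    ; fan = ear-fan G fanGraph third a b inner nonempty unique new a≢b Va Vb }
    where
    open Ear ear
    open Stage st
    to : ∀ w → w ∈ path × V G w → w ≡ a ⊎ w ≡ b
    to w (here p , _) = inj₁ p
    to w (there m , Vw) with ∈-∷ʳ⁻ inner m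
    ... | inj₁ m′ = ⊥-elim (new m′ Vw)
    ... | inj₂ p = inj₂ p
    from : ∀ w → w ≡ a ⊎ w ≡ b → w ∈ path × V G w
    from w (inj₁ refl) = here refl , Va
    from w (inj₂ refl) = there (∈-∷ʳ⁺ inner) , Vb
    edge-disjoint : ∀ {u v} → E G u v → ¬ PathEdge path u v
    edge-disjoint e pe = [ (λ u∈ → new u∈ (E⇒V (E-sym e))) , (λ v∈ → new v∈ (E⇒V e)) ]′
                           (PathEdge-inner a inner b nonempty pe)
      where open FanGraph fanGraph

  Stage-⊕ : ∀ {G} → Stage G → (ear : Ear G) → Stage (G ⊕ Ear.path ear)
  Stage-⊕ {G} st ear = record
    { fanGraph = record { E-sym = ⊕-sym G path E-sym ; E⇒V = ⊕-E⇒V G path E⇒V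
                        ; fan = ProperEar.fan (proper-ear st ear) }
    ; V? = λ w → V? w ⊎-dec w ∈? path
    ; E? = λ u v → E? u v ⊎-dec PathEdge? path u v
    ; third = λ p q → let x , Vx , x≢p , x≢q = third p q in x , inj₁ Vx , x≢p , x≢q
    ; ⊆H = λ { (inj₁ e) → ⊆H e ; (inj₂ e) → PathEdge-linked Adj-sym path linked e } }
    where
    open Ear ear using (path; linked)
    open Stage st
    open FanGraph fanGraph
    open DecMembership (_≟_ {n}) using (_∈?_)

  EarSequence : SubGraph n → List (List (Fin n)) → Set
  EarSequence G [] = (∀ w → V G w) × (∀ {u v} → Adj u v → E G u v)
  EarSequence G (ps ∷ es) = ProperEar G ps × EarSequence (G ⊕ ps) es

  module Grow (nc : NonChorded (full H)) (find-ear : ∀ {G} → Stage G → ∀ {w} → ¬ V G w → Ear G) where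

    spanning : ∀ {G} → Stage G → ∀ {out} → (∀ {w} → ¬ V G w → w ∈ out) →
               ¬ Any (λ w → ¬ V G w) out → ∀ w → V G w
    spanning st covers none w with Stage.V? st w
    ... | yes Vw = Vw
    ... | no ¬Vw = ⊥-elim (none (Any.map (λ { refl → ¬Vw }) (covers ¬Vw)))

    complete : ∀ {G} → Stage G → (∀ w → V G w) → EarSequence G []
    complete st spans = spans , spanning-fan-complete fanGraph E? ⊆H spans nc
      where open Stage st

    -- out over-approximates the vertices still missing from G, and its length
    -- bounds the number of ears still to come.
    grow : ∀ k {G} → Stage G → (out : List (Fin n)) → (∀ {w} → ¬ V G w → w ∈ out) → length out ≤ k →
           Σ[ es ∈ List (List (Fin n)) ] EarSequence G es
    grow zero st [] covers _ = [] , complete st (spanning st covers λ ())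
    grow (suc k) {G} st out covers bound with any? (¬? ∘ Stage.V? st) out
    ... | no none = [] , complete st (spanning st covers none)
    ... | yes some = Ear.path ear ∷ proj₁ rest , proper-ear st ear , proj₂ rest
      where
      ear : Ear G
      ear = find-ear st (proj₂ (Any.satisfied some))
      st′ : Stage (G ⊕ Ear.path ear)
      st′ = Stage-⊕ st ear
      out′ : List (Fin n)
      out′ = filter (¬? ∘ Stage.V? st′) out
      covers′ : ∀ {w} → ¬ V (G ⊕ Ear.path ear) w → w ∈ out′
      covers′ ¬Vw = ∈-filter⁺ (¬? ∘ Stage.V? st′) (covers (¬Vw ∘ inj₁)) ¬Vw
      shrinks : length out′ < length out
      shrinks with nonempty-∈ (Ear.inner ear) (Ear.nonempty ear)
      ... | z , z∈inner = filter-notAll (¬? ∘ Stage.V? st′) out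
            (Any.map (λ { refl ¬Vz → ¬Vz (inj₂ (there (∈-++⁺ˡ z∈inner))) }) (covers (Ear.new ear z∈inner)))
      rest : Σ[ es ∈ List (List (Fin n)) ] EarSequence (G ⊕ Ear.path ear) es
      rest = grow k st′ out′ covers′ (s≤s⁻¹ (≤-trans shrinks bound))

  ear-at : ∀ {G} es → EarSequence G es → (j : Fin (length es)) →
           ProperEar (G ⊕* take (toℕ j) es) (lookup es j)
  ear-at (ps ∷ es) (ear , _) zero = ear
  ear-at (ps ∷ es) (_ , seq) (suc j) = ear-at es seq j

  fan-after : ∀ {G} es → EarSequence G es → (j : Fin (length es)) → HasFan (G ⊕* take (suc (toℕ j)) es)
  fan-after (ps ∷ es) (ear , _) zero = ProperEar.fan ear
  fan-after (ps ∷ es) (_ , seq) (suc j) = fan-after es seq j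

  sequence-end : ∀ {G} es → EarSequence G es → EarSequence (G ⊕* es) []
  sequence-end [] done = done
  sequence-end (ps ∷ es) (_ , seq) = sequence-end es seq

  neighbour : Connected (full H) → ∀ {u t} → u ≢ t → Σ[ v ∈ Fin n ] Adj u v
  neighbour connected u≢t with uncons (PathWalk.walk (connected-walk connected _ _)) u≢t
  ... | v , uv , _ = v , uv

  other-neighbour : Biconnected (full H) → ∀ {u v t} → Adj u v → t ≢ u → t ≢ v →
                    Σ[ v′ ∈ Fin n ] (Adj u v′ × v′ ≢ v)
  other-neighbour (_ , connected-without) {u} {v} {t} uv t≢u t≢v
    with uncons (PathWalk.walk (connected-walk (connected-without v _) (_ , λ { refl → Adj-irrefl uv }) (_ , t≢v)))
                (λ u≡t → t≢u (sym u≡t))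
  ... | v′ , (uv′ , _ , v′≢v) , _ = v′ , uv′ , v′≢v

  cycle-through : Biconnected (full H) → ∀ {u v v′} → Adj u v → Adj u v′ → v ≢ v′ →
                  Σ[ xs ∈ List (Fin n) ] IsCycle (full H) (u ∷ xs)
  cycle-through (_ , connected-without) {u} {v} {v′} uv uv′ v≢v′ =
    vertices B , proj₁ (closing-cycle (λ e → e) u B uv (Adj-sym uv′) B-unique u∉B v≢v′)
    where
    avoiding-u : PathWalk (full H ─ u) v v′
    avoiding-u = connected-walk (connected-without u _)
                   (_ , λ { refl → Adj-irrefl uv }) (_ , λ { refl → Adj-irrefl uv′ })
    B : Walk Adj v v′
    B = mapʷ proj₁ (PathWalk.walk avoiding-u)
    B≡ : vertices B ≡ vertices (PathWalk.walk avoiding-u)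
    B≡ = vertices-mapʷ proj₁ (PathWalk.walk avoiding-u)
    B-unique : Unique (vertices B)
    B-unique = subst Unique (sym B≡) (PathWalk.unique avoiding-u)
    u∉B : u ∉ vertices B
    u∉B m = proj₂ (All.lookup (PathWalk.inside avoiding-u) (subst (u ∈_) B≡ m)) refl

  initial-cycle : 3 ≤ n → Biconnected (full H) →
                  Σ[ x ∈ Fin n ] Σ[ xs ∈ List (Fin n) ] IsCycle (full H) (x ∷ xs)
  initial-cycle (s≤s (s≤s (s≤s _))) biconnected
    with neighbour (proj₁ biconnected) {zero} {suc zero} (λ ())
  ... | v , uv
    with distinct⇒ThirdVertex {V = λ _ → ⊤} {zero} {suc zero} {suc (suc zero)} _ _ _ (λ ()) (λ ()) (λ ()) zero v
  ... | t , _ , t≢u , t≢v with other-neighbour biconnected uv t≢u t≢v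
  ... | v′ , uv′ , v′≢v = zero , cycle-through biconnected uv uv′ (λ v≡v′ → v′≢v (sym v≡v′))

  Cycle : List (Fin n) → SubGraph n
  Cycle C = record { V = _∈ C ; E = CycEdge C }

  unique⇒ThirdVertex : ∀ {xs : List (Fin n)} → Unique xs → 3 ≤ length xs → ThirdVertex (_∈ xs)
  unique⇒ThirdVertex {x ∷ y ∷ z ∷ _} ((x≢y ∷ x≢z ∷ _) ∷ (y≢z ∷ _) ∷ _) _ =
    distinct⇒ThirdVertex (here refl) (there (here refl)) (there (there (here refl))) x≢y x≢z y≢z
  unique⇒ThirdVertex {_ ∷ []} _ (s≤s ())
  unique⇒ThirdVertex {_ ∷ _ ∷ []} _ (s≤s (s≤s ()))

  cycle-stage : ∀ x xs → IsCycle (full H) (x ∷ xs) → Stage (Cycle (x ∷ xs))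
  cycle-stage x xs (3≤ , unique , _ , linked) = record
    { fanGraph = record
      { E-sym = PathEdge-sym L
      ; E⇒V = λ e → [ (λ m → m) , (λ { refl → here refl }) ]′
                      (∈-∷ʳ⁻ (x ∷ xs) (proj₂ (PathEdge-∈ L e)))
      ; fan = Fan-mono (λ m → inj₂ (∈-++⁺ˡ m)) (λ { (inj₂ e) → e })
                       (cycle-fan x xs unique (s≤s⁻¹ 3≤)) }
    ; V? = λ w → w ∈? (x ∷ xs)
    ; E? = PathEdge? L
    ; third = unique⇒ThirdVertex unique 3≤
    ; ⊆H = PathEdge-linked Adj-sym L linked }
    where
    L : List (Fin n)
    L = x ∷ xs ++ [ x ]
    open DecMembership (_≟_ {n}) using (_∈?_)

  -- Reading off the decomposition

  module Assemble (nc : NonChorded (full H)) (C : List (Fin n)) (st : Stage (Cycle C))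
    (es : List (List (Fin n))) (seq : EarSequence (Cycle C) es) where

    open Stage st using (fanGraph; ⊆H)

    k : ℕ
    k = length es

    P : Fin k → List (Fin n)
    P = lookup es

    a b : Fin k → Fin n
    a j = ProperEar.a (ear-at es seq j)
    b j = ProperEar.b (ear-at es seq j)

    stage : ℕ → SubGraph n
    stage i = Cycle C ⊕* take i es

    V-stage⇒F : ∀ i {w} → V (stage i) w → V (F C P i) w
    V-stage⇒F i v = [ inj₁ , (λ m → inj₂ (Any-take⁻ i es m)) ]′ (V-⊕*⁻ (Cycle C) (take i es) v)

    V-F⇒stage : ∀ i {w} → V (F C P i) w → V (stage i) w
    V-F⇒stage i (inj₁ m) = V-⊕*⁺ (Cycle C) (take i es) (inj₁ m)
    V-F⇒stage i (inj₂ earlier) = V-⊕*⁺ (Cycle C) (take i es) (inj₂ (Any-take⁺ i es earlier))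

    E-stage⇒F : ∀ i {u v} → E (stage i) u v → E (F C P i) u v
    E-stage⇒F i e = [ inj₁ , (λ m → inj₂ (Any-take⁻ i es m)) ]′ (E-⊕*⁻ (Cycle C) (take i es) e)

    E-F⇒stage : ∀ i {u v} → E (F C P i) u v → E (stage i) u v
    E-F⇒stage i (inj₁ ce) = E-⊕*⁺ (Cycle C) (take i es) (inj₁ ce)
    E-F⇒stage i (inj₂ earlier) = E-⊕*⁺ (Cycle C) (take i es) (inj₂ (Any-take⁺ i es earlier))

    ear-⊆H : ∀ j {u v} → PathEdge (P j) u v → Adj u v
    ear-⊆H j = PathEdge-linked Adj-sym (P j) (IsPath-linked (P j) (ProperEar.isPath (ear-at es seq j)))

    F⊆H : ∀ i {u v} → E (F C P i) u v → Adj u v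
    F⊆H i (inj₁ ce) = ⊆H ce
    F⊆H i (inj₂ (j , _ , pe)) = ear-⊆H j pe

    F-fanGraph : ∀ (j : Fin k) → FanGraph (F C P (suc (toℕ j)))
    F-fanGraph j = record
      { E-sym = λ { (inj₁ ce) → inj₁ (FanGraph.E-sym fanGraph ce)
                  ; (inj₂ (i , i<j , pe)) → inj₂ (i , i<j , PathEdge-sym (P i) pe) }
      ; E⇒V = λ { (inj₁ ce) → inj₁ (FanGraph.E⇒V fanGraph ce)
                ; (inj₂ (i , i<j , pe)) → inj₂ (i , i<j , proj₂ (PathEdge-∈ (P i) pe)) }
      ; fan = Fan-mono (V-F⇒stage (suc (toℕ j))) (E-stage⇒F (suc (toℕ j))) (fan-after es seq j) }

    take-k : take k es ≡ es
    take-k = take-all k es ≤-refl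

    complete-stage : EarSequence (stage k) []
    complete-stage = subst (λ t → EarSequence (Cycle C ⊕* t) []) (sym take-k) (sequence-end es seq)

    ears-are-paths : ∀ j → IsPath (full H) (P j) × 3 ≤ length (P j) × Ends (P j) (a j) (b j) × a j ≢ b j
    ears-are-paths j = isPath , long , ends , a≢b
      where open ProperEar (ear-at es seq j)

    edges-partition : ∀ u v → E (full H) u v ⇔ (CycEdge C u v ⊎ Σ[ j ∈ Fin k ] PathEdge (P j) u v)
    edges-partition u v = mk⇔
      (λ uv → [ inj₁ , (λ { (j , _ , pe) → inj₂ (j , pe) }) ]′ (E-stage⇒F k (proj₂ complete-stage uv)))
      [ ⊆H , (λ { (j , pe) → ear-⊆H j pe }) ]′

    cycle-ear-disjoint : ∀ u v (j : Fin k) → ¬ (CycEdge C u v × PathEdge (P j) u v)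
    cycle-ear-disjoint u v j (ce , pe) =
      ProperEar.edge-disjoint (ear-at es seq j) (E-⊕*⁺ (Cycle C) (take (toℕ j) es) (inj₁ ce)) pe

    -- The later of two ears avoids the edges of the earlier one.
    ears-disjoint : ∀ u v (i j : Fin k) → i ≢ j → ¬ (PathEdge (P i) u v × PathEdge (P j) u v)
    ears-disjoint u v i j i≢j (pi , pj) with <-cmp (toℕ i) (toℕ j)
    ... | tri< i<j _ _ = ProperEar.edge-disjoint (ear-at es seq j) (E-F⇒stage (toℕ j) (inj₂ (i , i<j , pi))) pj
    ... | tri≈ _ i≡j _ = i≢j (toℕ-injective i≡j)
    ... | tri> _ _ j<i = ProperEar.edge-disjoint (ear-at es seq i) (E-F⇒stage (toℕ i) (inj₂ (j , j<i , pj))) pi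

    attachments : ∀ (j : Fin k) w → (w ∈ P j × V (F C P (toℕ j)) w) ⇔ (w ≡ a j ⊎ w ≡ b j)
    attachments j w = mk⇔
      (λ (m , v) → Equivalence.to (attachment w) (m , V-F⇒stage (toℕ j) v))
      (λ ends → let m , v = Equivalence.from (attachment w) ends in m , V-stage⇒F (toℕ j) v)
      where open ProperEar (ear-at es seq j)

    stages-nonchorded-biconnected : ∀ (j : Fin k) →
      NonChorded (F C P (suc (toℕ j))) × Biconnected (F C P (suc (toℕ j)))
    stages-nonchorded-biconnected j =
      NonChorded-⊆ (F C P (suc (toℕ j))) (F⊆H (suc (toℕ j))) nc , fan⇒biconnected (F-fanGraph j)

    decomposition : 1 ≤ k → EarDecomposition H C
    decomposition 1≤k =
      k , P , a , b , 1≤k , ears-are-paths , edges-partition , cycle-ear-disjoint , ears-disjoint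
      , attachments , stages-nonchorded-biconnected
      , (λ w → V-stage⇒F k (proj₁ complete-stage w))
      , (λ u v → mk⇔ (λ uv → E-stage⇒F k (proj₂ complete-stage uv)) (F⊆H k))

  cycle-and-ears : 3 ≤ n → NonChorded (full H) → Biconnected (full H) →
    Σ[ C ∈ List (Fin n) ] (IsCycle (full H) C × (HamiltonianAll H C ⊎ EarDecomposition H C))
  cycle-and-ears n≥3 nc biconnected with initial-cycle n≥3 biconnected
  ... | x , xs , cycle
    with Grow.grow nc (λ st → FindEar.ear (Stage.V? st) (Stage.third st) biconnected)
           (length (allFin n)) (cycle-stage x xs cycle) (allFin n) (λ {w} _ → ∈-allFin w) ≤-refl
  ... | [] , spans , complete =
    x ∷ xs , cycle , inj₁ (spans , λ u v → mk⇔ complete (Stage.⊆H (cycle-stage x xs cycle)))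
  ... | ears@(_ ∷ _) , seq =
    x ∷ xs , cycle , inj₂ (Assemble.decomposition nc (x ∷ xs) (cycle-stage x xs cycle) ears seq (s≤s z≤n))

proposition2 : ∀ {n} (H : Graph n) → 4 ≤ n
    → NonChorded (full H) → Biconnected (full H)
    → Σ[ C ∈ List (Fin n) ] (IsCycle (full H) C × (HamiltonianAll H C ⊎ EarDecomposition H C))
proposition2 H n≥4 = Host.cycle-and-ears H (≤-trans (n≤1+n 3) n≥4)
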